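{- There exist absolute constants $\gamma_1 > 0$ and $C$ such that the following holds. Let $n \ge 2$ and $0 \le k \le n/2$ be integers, $p = k/n$, and $f\colon\binom{[n]}{k}\to\{0,1\}$. Let $S \subseteq [n]$ with $|S| \le n/2$, $m$ real, and $\gamma = \|f - (\sum_{i\in S} x_i + m)\|^2$. If $\gamma \le \gamma_1$, then there is $\mu \in \{0,1\}$ such that $\|f - (\sum_{i \in S} x_i + \mu)\|^2 \le C\gamma$; furthermore $|S| \le \frac{3}{2}p^{ -1}$ and $|m - \mu| \le C\sqrt{\gamma}$.
   Context: $\binom{[n]}{k} = \{x \in \{0,1\}^n : \sum_i x_i = k\}$ with the uniform probability measure; $\|h\|^2 = \mathbb{E}[h^2]$. When $k=0$ the bound $|S| \le \frac32 p^{ -1}$ is read as vacuous.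
   Formalization: The shift m is taken rational rather than real, so γ is rational as well. -}

module Defs where

open import Data.Bool using (Bool; true; false)
open import Data.Nat as ℕ using (ℕ; zero; suc)
open import Data.Integer using (ℤ; +_)
open import Data.List using (List; []; _∷_; _++_; map; filterᵇ; length; foldr)
open import Data.Vec using (Vec; []; _∷_)
open import Data.Rational using (ℚ; 0ℚ; _+_; _*_; _-_; _/_)
open import Data.Fin.Subset using (Subset; inside; outside)

weight : ∀ {n} → Vec Bool n → ℕ
weight [] = 0
weight (true ∷ x) = suc (weight x)
weight (false ∷ x) = weight x

cube : (n : ℕ) → List (Vec Bool n)
cube zero = [] ∷ []
cube (suc n) = map (true ∷_) (cube n) ++ map (false ∷_) (cube n)

slice : (n k : ℕ) → List (Vec Bool n)
slice n k = filterᵇ (λ x → weight x ℕ.≡ᵇ k) (cube n)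

toℚ : Bool → ℚ
toℚ true = + 1 / 1
toℚ false = 0ℚ

ℕtoℚ : ℕ → ℚ
ℕtoℚ k = + k / 1

sumOver : ∀ {n} → Subset n → Vec Bool n → ℕ
sumOver [] [] = 0
sumOver (inside ∷ S) (true ∷ x) = suc (sumOver S x)
sumOver (inside ∷ S) (false ∷ x) = sumOver S x
sumOver (outside ∷ S) (_ ∷ x) = sumOver S x

average : List ℚ → ℚ
average xs with length xs
... | zero = 0ℚ
... | suc l = foldr _+_ 0ℚ xs * (+ 1 / suc l)

𝔼 : (n k : ℕ) → (Vec Bool n → ℚ) → ℚ
𝔼 n k h = average (map h (slice n k))

‖_‖²[_] : ∀ {n} → (Vec Bool n → ℚ) → (k : ℕ) → ℚ
‖_‖²[_] {n} h k = 𝔼 n k (λ x → h x * h x)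

dist² : (n k : ℕ) → (Vec Bool n → Bool) → Subset n → ℚ → ℚ
dist² n k f S c = ‖ (λ x → toℚ (f x) - (ℕtoℚ (sumOver S x) + c)) ‖²[ k ]

module Submission where

-- Call x bad when the residual r(x) = f(x) − (X(x) + m), with X(x) = Σ_{i∈S} x_i, has r(x)² ≥ ¼.
-- By Markov fewer than N/33 of the N points of the slice are bad, so some x₀ is good.  For the
-- integer a = f(x₀) − X(x₀) and e = m − a this gives e² < ¼, and r(x) = d(x) − e where
-- d(x) = f(x) − X(x) − a is an integer and is the residual for a in place of m.  Hence d² ≤ 4r²,
-- e² ≤ r², and d(x) ≠ 0 makes x bad, so every good x has X(x) ∈ {t, t+1} with t = X(x₀) − f(x₀)
-- (truncated).  The level counts N_i = #{x : X(x) = i} = C(|S|, i) C(n − |S|, k − i) form a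
-- hypergeometric sequence which, for |S|, k ≤ n/2, cannot concentrate on two consecutive levels:
-- N_t + N_{t+1} ≤ 32 (N_{t−1} + N_{t+2}) for t ≥ 1, and N_0 + N_1 ≤ 10 N_2 unless 2|S|k ≤ 3n.  As the
-- neighbouring levels consist of bad points, t = 0, which makes a ∈ {0, 1} the required μ, and
-- 2|S|k ≤ 3n.

open import Defs
open import Data.Bool using (Bool; true; false; _∧_; T)
open import Data.Bool.Properties using (∧-zeroʳ; ∧-identityʳ)
open import Data.Empty using (⊥; ⊥-elim)
open import Data.Fin.Subset using (Subset; inside; outside; ∁; ∣_∣)
open import Data.List using (List; []; _∷_; _++_; map; filterᵇ; length; foldr)
open import Data.List.Properties using (length-map)
open import Data.Product using (Σ; ∃; _×_; _,_; proj₁; proj₂)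
import Data.Sum as Sum
open import Data.Sum using (_⊎_; inj₁; inj₂; [_,_]′)
open import Data.Vec using (Vec; []; _∷_)
open import Function using (id; _∘_)
open import Relation.Binary.PropositionalEquality
  using (_≡_; _≢_; refl; sym; trans; cong; cong₂; subst; subst₂; module ≡-Reasoning)

module Sums where

  open import Data.Nat using (ℕ; suc; _+_; _≤_; _<_; z≤n)
  open import Data.Nat.Properties using (+-assoc; +-mono-≤; ≤-refl; ≤-trans; m≤m+n; m≤n+m; ≤-pred)
  open import Data.Nat.Tactic.RingSolver using (solve-∀)

  bit : Bool → ℕ
  bit false = 0
  bit true = 1

  T⇒1≤bit : ∀ {b} → T b → 1 ≤ bit b
  T⇒1≤bit {true} _ = ≤-refl

  T-or-false : ∀ b → T b ⊎ b ≡ false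
  T-or-false true = inj₁ _
  T-or-false false = inj₂ refl

  ∑ : {A : Set} → (A → ℕ) → List A → ℕ
  ∑ h [] = 0
  ∑ h (x ∷ xs) = h x + ∑ h xs

  module _ {A : Set} where

    ∑-++ : ∀ (h : A → ℕ) xs ys → ∑ h (xs ++ ys) ≡ ∑ h xs + ∑ h ys
    ∑-++ h [] ys = refl
    ∑-++ h (x ∷ xs) ys = trans (cong (h x +_) (∑-++ h xs ys)) (sym (+-assoc (h x) _ _))

    ∑-map : ∀ {B : Set} (h : B → ℕ) (g : A → B) xs → ∑ h (map g xs) ≡ ∑ (h ∘ g) xs
    ∑-map h g [] = refl
    ∑-map h g (x ∷ xs) = cong (h (g x) +_) (∑-map h g xs)

    ∑-cong : ∀ {g h : A → ℕ} → (∀ x → g x ≡ h x) → ∀ xs → ∑ g xs ≡ ∑ h xs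
    ∑-cong g≗h [] = refl
    ∑-cong g≗h (x ∷ xs) = cong₂ _+_ (g≗h x) (∑-cong g≗h xs)

    ∑-mono : ∀ {g h : A → ℕ} → (∀ x → g x ≤ h x) → ∀ xs → ∑ g xs ≤ ∑ h xs
    ∑-mono g≤h [] = z≤n
    ∑-mono g≤h (x ∷ xs) = +-mono-≤ (g≤h x) (∑-mono g≤h xs)

    ∑-+ : ∀ (g h : A → ℕ) xs → ∑ (λ x → g x + h x) xs ≡ ∑ g xs + ∑ h xs
    ∑-+ g h [] = refl
    ∑-+ g h (x ∷ xs) = trans (cong (g x + h x +_) (∑-+ g h xs)) (interchange (g x) (h x) _ _)
      where
      interchange : ∀ a b c d → a + b + (c + d) ≡ a + c + (b + d)
      interchange = solve-∀

    ∑1≡length : ∀ (xs : List A) → ∑ (λ _ → 1) xs ≡ length xs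
    ∑1≡length [] = refl
    ∑1≡length (x ∷ xs) = cong suc (∑1≡length xs)

    count : (A → Bool) → List A → ℕ
    count p = ∑ (bit ∘ p)

    count-false : ∀ xs → count (λ _ → false) xs ≡ 0
    count-false [] = refl
    count-false (x ∷ xs) = count-false xs

    count-filterᵇ : ∀ p q xs → count p (filterᵇ q xs) ≡ count (λ x → q x ∧ p x) xs
    count-filterᵇ p q [] = refl
    count-filterᵇ p q (x ∷ xs) with q x
    ... | false = count-filterᵇ p q xs
    ... | true = cong (bit (p x) +_) (count-filterᵇ p q xs)

    count≤length : ∀ p xs → count p xs ≤ length xs
    count≤length p xs = subst (count p xs ≤_) (∑1≡length xs) (∑-mono bit≤1 xs)
      where
      bit≤1 : ∀ x → bit (p x) ≤ 1
      bit≤1 x with p x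
      ... | false = z≤n
      ... | true = ≤-refl

    count<length⇒∃false : ∀ p xs → count p xs < length xs → ∃ λ x → p x ≡ false
    count<length⇒∃false p (x ∷ xs) lt with p x in px
    ... | false = x , px
    ... | true = count<length⇒∃false p xs (≤-pred lt)

    count-mono : ∀ {p r : A → Bool} → (∀ x → T (p x) → T (r x)) → ∀ xs → count p xs ≤ count r xs
    count-mono {p} {r} p⇒r = ∑-mono pointwise
      where
      pointwise : ∀ x → bit (p x) ≤ bit (r x)
      pointwise x with p x | p⇒r x
      ... | false | _ = z≤n
      ... | true | p⇒rx = T⇒1≤bit (p⇒rx _)

    count-disjoint : ∀ {p q r : A → Bool} → (∀ x → T (p x) → T (r x)) → (∀ x → T (q x) → T (r x)) →
      (∀ x → T (p x) → T (q x) → ⊥) → ∀ xs → count p xs + count q xs ≤ count r xs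
    count-disjoint {p} {q} {r} p⇒r q⇒r p#q xs = subst (_≤ count r xs) (∑-+ (bit ∘ p) (bit ∘ q) xs) (∑-mono pointwise xs)
      where
      pointwise : ∀ x → bit (p x) + bit (q x) ≤ bit (r x)
      pointwise x with p x | q x | p⇒r x | q⇒r x | p#q x
      ... | false | false | _ | _ | _ = z≤n
      ... | true | false | p⇒rx | _ | _ = T⇒1≤bit (p⇒rx _)
      ... | false | true | _ | q⇒rx | _ = T⇒1≤bit (q⇒rx _)
      ... | true | true | _ | _ | p#qx = ⊥-elim (p#qx _ _)

    count-cover : ∀ {p q r : A → Bool} → (∀ x → T (p x) ⊎ T (q x) ⊎ T (r x)) →
      ∀ xs → length xs ≤ count p xs + count q xs + count r xs
    count-cover {p} {q} {r} cover xs = subst₂ _≤_ (∑1≡length xs) counts (∑-mono pointwise xs)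
      where
      counts : ∑ (λ x → bit (p x) + bit (q x) + bit (r x)) xs ≡ count p xs + count q xs + count r xs
      counts = trans (∑-+ (λ x → bit (p x) + bit (q x)) (bit ∘ r) xs) (cong (_+ count r xs) (∑-+ (bit ∘ p) (bit ∘ q) xs))
      pointwise : ∀ x → 1 ≤ bit (p x) + bit (q x) + bit (r x)
      pointwise x with cover x
      ... | inj₁ px = ≤-trans (T⇒1≤bit px) (≤-trans (m≤m+n _ (bit (q x))) (m≤m+n _ (bit (r x))))
      ... | inj₂ (inj₁ qx) = ≤-trans (T⇒1≤bit qx) (≤-trans (m≤n+m _ (bit (p x))) (m≤m+n _ (bit (r x))))
      ... | inj₂ (inj₂ rx) = ≤-trans (T⇒1≤bit rx) (m≤n+m _ _)

module Binomial where

  open import Data.Nat using (ℕ; zero; suc; _+_; _*_; _∸_; _≤_; _<_; z≤n; s≤s; _<?_)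
  open import Data.Nat.Properties
  open import Data.Nat.Tactic.RingSolver using (solve-∀)
  open import Data.Nat.Combinatorics using (_C_; nCk+nC[k+1]≡[n+1]C[k+1]; k>n⇒nCk≡0; nC1≡n)
  open import Relation.Nullary using (yes; no)
  open ≡-Reasoning

  k≤n⇒0<nCk : ∀ {n k} → k ≤ n → 0 < n C k
  k≤n⇒0<nCk {zero} z≤n = s≤s z≤n
  k≤n⇒0<nCk {suc n} z≤n = s≤s z≤n
  k≤n⇒0<nCk {suc n} {suc k} (s≤s k≤n) =
    subst (0 <_) (nCk+nC[k+1]≡[n+1]C[k+1] n k) (<-≤-trans (k≤n⇒0<nCk k≤n) (m≤m+n _ _))

  [1+k]nC[1+k]≡[n∸k]nCk : ∀ n k → suc k * (n C suc k) ≡ (n ∸ k) * (n C k)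
  [1+k]nC[1+k]≡[n∸k]nCk zero k = begin
    suc k * 0          ≡⟨ *-zeroʳ (suc k) ⟩
    0                  ≡⟨ cong (_* (0 C k)) (0∸n≡0 k) ⟨
    (0 ∸ k) * (0 C k)  ∎
  [1+k]nC[1+k]≡[n∸k]nCk (suc n) zero = begin
    1 * (suc n C 1)  ≡⟨ *-identityˡ _ ⟩
    suc n C 1      ≡⟨ nC1≡n (suc n) ⟩
    suc n          ≡⟨ *-identityʳ (suc n) ⟨
    suc n * 1      ∎
  [1+k]nC[1+k]≡[n∸k]nCk (suc n) (suc k) = begin
    suc (suc k) * (suc n C suc (suc k))    ≡⟨ cong (suc (suc k) *_) (nCk+nC[k+1]≡[n+1]C[k+1] n (suc k)) ⟨
    suc (suc k) * (P + Q)                  ≡⟨ *-distribˡ-+ (suc (suc k)) P Q ⟩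
    suc (suc k) * P + suc (suc k) * Q      ≡⟨ cong (suc (suc k) * P +_) ([1+k]nC[1+k]≡[n∸k]nCk n (suc k)) ⟩
    suc (suc k) * P + (n ∸ suc k) * P      ≡⟨ shift k (n ∸ suc k) P ⟩
    suc k * P + suc (n ∸ suc k) * P        ≡⟨ cong (suc k * P +_) 1+[n∸1+k]-on-P ⟩
    suc k * P + (n ∸ k) * P                ≡⟨ cong (_+ (n ∸ k) * P) ([1+k]nC[1+k]≡[n∸k]nCk n k) ⟩
    (n ∸ k) * R + (n ∸ k) * P              ≡⟨ *-distribˡ-+ (n ∸ k) R P ⟨
    (n ∸ k) * (R + P)                      ≡⟨ cong ((n ∸ k) *_) (nCk+nC[k+1]≡[n+1]C[k+1] n k) ⟩
    (n ∸ k) * (suc n C suc k)              ∎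
    where
    P = n C suc k
    Q = n C suc (suc k)
    R = n C k
    shift : ∀ k x P → suc (suc k) * P + x * P ≡ suc k * P + suc x * P
    shift = solve-∀
    1+[n∸1+k]-on-P : suc (n ∸ suc k) * P ≡ (n ∸ k) * P
    1+[n∸1+k]-on-P with k <? n
    ... | yes k<n = sym (cong (_* P) (+-∸-assoc 1 k<n))
    ... | no k≮n = begin
      suc (n ∸ suc k) * P  ≡⟨ cong (suc (n ∸ suc k) *_) P≡0 ⟩
      suc (n ∸ suc k) * 0  ≡⟨ *-zeroʳ (suc (n ∸ suc k)) ⟩
      0                    ≡⟨ *-zeroʳ (n ∸ k) ⟨
      (n ∸ k) * 0          ≡⟨ cong ((n ∸ k) *_) P≡0 ⟨
      (n ∸ k) * P          ∎
      where
      P≡0 : P ≡ 0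
      P≡0 = k>n⇒nCk≡0 (s≤s (≮⇒≥ k≮n))

module HypergeometricBounds where

  open import Data.Nat using (ℕ; zero; suc; _+_; _*_; _∸_; _≤_; _<_; z≤n; s≤s; _≤?_; NonZero; >-nonZero)
  open import Data.Nat.Properties
  open import Data.Nat.Tactic.RingSolver using (solve-∀)
  open import Relation.Nullary using (Dec; yes; no)
  open ≤-Reasoning

  record Hypergeometric (N : ℕ → ℕ) (s k c : ℕ) : Set where
    field
      ratio : ∀ i → N (suc i) * suc i * (i + c) ≡ N i * (s ∸ i) * (k ∸ i)

  [2+a][2+b]≤4[1+a][1+b] : ∀ a b → (2 + a) * (2 + b) ≤ 4 * ((1 + a) * (1 + b))
  [2+a][2+b]≤4[1+a][1+b] a b = subst ((2 + a) * (2 + b) ≤_) (expand a b) (m≤m+n _ (3 * a * b + 2 * a + 2 * b))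
    where
    expand : ∀ a b → (2 + a) * (2 + b) + (3 * a * b + 2 * a + 2 * b) ≡ 4 * ((1 + a) * (1 + b))
    expand = solve-∀

  [2+j][1+m]≤4[1+j]m : ∀ j {m} → 0 < m → (2 + j) * suc m ≤ 4 * (suc j * m)
  [2+j][1+m]≤4[1+j]m j {suc w} _ = [2+a][2+b]≤4[1+a][1+b] j w

  module _ {c : ℕ} where

    balanced⇒0<c : ∀ {u v} → u < v + c → v < u + c → 0 < c
    balanced⇒0<c {u} {v} u<v+c v<u+c = n≢0⇒n>0 λ c≡0 → <-asym (lower c≡0 u<v+c) (lower c≡0 v<u+c)
      where
      lower : ∀ {a b} → c ≡ 0 → a < b + c → a < b
      lower {a} {b} c≡0 = subst (a <_) (trans (cong (b +_) c≡0) (+-identityʳ b))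

    small-factor⇒uv≤c : ∀ {u v} → u < v + c → v < u + c → u ≤ 1 ⊎ v ≤ 1 → u * v ≤ c
    small-factor⇒uv≤c _ _ (inj₁ z≤n) = z≤n
    small-factor⇒uv≤c {v = v} _ v<1+c (inj₁ (s≤s z≤n)) = subst (_≤ c) (sym (*-identityˡ v)) (≤-pred v<1+c)
    small-factor⇒uv≤c {u} _ _ (inj₂ z≤n) = subst (_≤ c) (sym (*-zeroʳ u)) z≤n
    small-factor⇒uv≤c {u} u<1+c _ (inj₂ (s≤s z≤n)) = subst (_≤ c) (sym (*-identityʳ u)) (≤-pred u<1+c)

    c≤16[1+j][j+c] : ∀ j → c ≤ 16 * (suc j * (j + c))
    c≤16[1+j][j+c] j = begin
      c                        ≤⟨ m≤n+m c j ⟩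
      j + c                    ≤⟨ m≤n*m (j + c) (suc j) ⟩
      suc j * (j + c)          ≤⟨ m≤n*m _ 16 ⟩
      16 * (suc j * (j + c))   ∎

    [1+u][1+v]≤16[1+j][j+c] : ∀ j u v → u < v + c → v < u + c →
      u * v ≤ (2 + j) * (suc j + c) →
      suc u * suc v ≤ 16 * (suc j * (j + c))
    [1+u][1+v]≤16[1+j][j+c] j zero v _ v<c _ =
      ≤-trans (subst (_≤ c) (sym (*-identityˡ (suc v))) v<c) (c≤16[1+j][j+c] j)
    [1+u][1+v]≤16[1+j][j+c] j (suc u) zero u<c _ _ =
      ≤-trans (subst (_≤ c) (sym (*-identityʳ (suc (suc u)))) u<c) (c≤16[1+j][j+c] j)
    [1+u][1+v]≤16[1+j][j+c] j (suc u) (suc v) u<v+c v<u+c uv≤ = begin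
      (2 + u) * (2 + v)                ≤⟨ [2+a][2+b]≤4[1+a][1+b] u v ⟩
      4 * (suc u * suc v)              ≤⟨ *-monoʳ-≤ 4 uv≤ ⟩
      4 * ((2 + j) * suc (j + c))      ≤⟨ *-monoʳ-≤ 4 ([2+j][1+m]≤4[1+j]m j 0<j+c) ⟩
      4 * (4 * (suc j * (j + c)))      ≡⟨ *-assoc 4 4 (suc j * (j + c)) ⟨
      16 * (suc j * (j + c))           ∎
      where
      0<j+c : 0 < j + c
      0<j+c = <-≤-trans (balanced⇒0<c u<v+c v<u+c) (m≤n+m c j)

    small-factor⇒uv≤[2+j][1+j+c] : ∀ j {u v} → u < v + c → v < u + c → u ≤ 1 ⊎ v ≤ 1 →
      u * v ≤ (2 + j) * (suc j + c)
    small-factor⇒uv≤[2+j][1+j+c] j {u} {v} u<v+c v<u+c small = begin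
      u * v                  ≤⟨ small-factor⇒uv≤c u<v+c v<u+c small ⟩
      c                      ≤⟨ m≤n+m c (suc j) ⟩
      suc j + c              ≤⟨ m≤n*m _ (2 + j) ⟩
      (2 + j) * (suc j + c)  ∎

    [3+j][2+j+c]≤16[u-1][v-1] : ∀ j u v → u < v + c → v < u + c →
      (2 + j) * (suc j + c) < u * v →
      (3 + j) * (2 + j + c) ≤ 16 * ((u ∸ 1) * (v ∸ 1))
    [3+j][2+j+c]≤16[u-1][v-1] j (suc (suc a)) (suc (suc b)) _ _ P<uv = begin
      (3 + j) * (2 + j + c)            ≤⟨ [2+a][2+b]≤4[1+a][1+b] (suc j) (j + c) ⟩
      4 * ((2 + j) * (suc j + c))      ≤⟨ *-monoʳ-≤ 4 (<⇒≤ P<uv) ⟩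
      4 * ((2 + a) * (2 + b))          ≤⟨ *-monoʳ-≤ 4 ([2+a][2+b]≤4[1+a][1+b] a b) ⟩
      4 * (4 * ((1 + a) * (1 + b)))    ≡⟨ *-assoc 4 4 ((1 + a) * (1 + b)) ⟨
      16 * ((1 + a) * (1 + b))         ∎
    [3+j][2+j+c]≤16[u-1][v-1] j zero v u< v< =
      ⊥-elim ∘ ≤⇒≯ (small-factor⇒uv≤[2+j][1+j+c] j u< v< (inj₁ z≤n))
    [3+j][2+j+c]≤16[u-1][v-1] j (suc zero) v u< v< =
      ⊥-elim ∘ ≤⇒≯ (small-factor⇒uv≤[2+j][1+j+c] j u< v< (inj₁ (s≤s z≤n)))
    [3+j][2+j+c]≤16[u-1][v-1] j (suc (suc a)) zero u< v< =
      ⊥-elim ∘ ≤⇒≯ (small-factor⇒uv≤[2+j][1+j+c] j u< v< (inj₂ z≤n))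
    [3+j][2+j+c]≤16[u-1][v-1] j (suc (suc a)) (suc zero) u< v< =
      ⊥-elim ∘ ≤⇒≯ (small-factor⇒uv≤[2+j][1+j+c] j u< v< (inj₂ (s≤s z≤n)))

    C≤B⇒B≤16A : ∀ {A B C} j u v → u < v + c → v < u + c →
      B * suc j * (j + c) ≡ A * suc u * suc v →
      C * (2 + j) * (suc j + c) ≡ B * u * v →
      C ≤ B → B ≤ 16 * A
    C≤B⇒B≤16A {B = zero} _ _ _ _ _ _ _ _ = z≤n
    C≤B⇒B≤16A {A} {B@(suc _)} {C} j u v u<v+c v<u+c e₁ e₂ C≤B = *-cancelʳ-≤ B (16 * A) Q (begin
      B * Q                    ≡⟨ *-assoc B (suc j) (j + c) ⟨
      B * suc j * (j + c)      ≡⟨ e₁ ⟩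
      A * suc u * suc v        ≡⟨ *-assoc A (suc u) (suc v) ⟩
      A * (suc u * suc v)      ≤⟨ *-monoʳ-≤ A ([1+u][1+v]≤16[1+j][j+c] j u v u<v+c v<u+c uv≤P) ⟩
      A * (16 * Q)             ≡⟨ *-assoc A 16 Q ⟨
      A * 16 * Q               ≡⟨ cong (_* Q) (*-comm A 16) ⟩
      16 * A * Q               ∎)
      where
      P = (2 + j) * (suc j + c)
      Q = suc j * (j + c)
      instance
        j+c≢0 : NonZero (j + c)
        j+c≢0 = >-nonZero (<-≤-trans (balanced⇒0<c u<v+c v<u+c) (m≤n+m c j))
        Q≢0 : NonZero Q
        Q≢0 = m*n≢0 (suc j) (j + c)
      uv≤P : u * v ≤ P
      uv≤P = *-cancelˡ-≤ B (begin
        B * (u * v)                ≡⟨ *-assoc B u v ⟨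
        B * u * v                  ≡⟨ e₂ ⟨
        C * (2 + j) * (suc j + c)  ≡⟨ *-assoc C (2 + j) (suc j + c) ⟩
        C * P                      ≤⟨ *-monoˡ-≤ P C≤B ⟩
        B * P                      ∎)

    B<C⇒C≤16D : ∀ {B C D} j u v → u < v + c → v < u + c →
      C * (2 + j) * (suc j + c) ≡ B * u * v →
      D * (3 + j) * (2 + j + c) ≡ C * (u ∸ 1) * (v ∸ 1) →
      B < C → C ≤ 16 * D
    B<C⇒C≤16D {B} {C} {D} j u v u<v+c v<u+c e₂ e₃ B<C = *-cancelʳ-≤ C (16 * D) Q (begin
      C * Q                              ≤⟨ *-monoʳ-≤ C ([3+j][2+j+c]≤16[u-1][v-1] j u v u<v+c v<u+c P<uv) ⟩
      C * (16 * ((u ∸ 1) * (v ∸ 1)))     ≡⟨ regroup C (u ∸ 1) (v ∸ 1) ⟩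
      16 * (C * (u ∸ 1) * (v ∸ 1))       ≡⟨ cong (16 *_) e₃ ⟨
      16 * (D * (3 + j) * (2 + j + c))   ≡⟨ regroup′ D (3 + j) (2 + j + c) ⟩
      16 * D * Q                         ∎)
      where
      P = (2 + j) * (suc j + c)
      Q = (3 + j) * (2 + j + c)
      regroup : ∀ a b d → a * (16 * (b * d)) ≡ 16 * (a * b * d)
      regroup = solve-∀
      regroup′ : ∀ a b d → 16 * (a * b * d) ≡ 16 * a * (b * d)
      regroup′ = solve-∀
      P<uv : P < u * v
      P<uv = ≰⇒> λ uv≤P → <-irrefl refl (begin-strict
        C * P                      ≡⟨ *-assoc C (2 + j) (suc j + c) ⟨
        C * (2 + j) * (suc j + c)  ≡⟨ e₂ ⟩
        B * u * v                  ≡⟨ *-assoc B u v ⟩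
        B * (u * v)                ≤⟨ *-monoʳ-≤ B uv≤P ⟩
        B * P                      <⟨ *-monoˡ-< P B<C ⟩
        C * P                      ∎)

  ∸-offsets : ∀ {x} j u → suc j + u ≡ x → (x ∸ j ≡ suc u) × (x ∸ suc j ≡ u) × (x ∸ (2 + j) ≡ u ∸ 1)
  ∸-offsets zero u refl = refl , refl , refl
  ∸-offsets (suc j) u refl = ∸-offsets j u refl

  x+y≤2*m*z : ∀ m {x y z} → y ≤ x → x ≤ m * z → x + y ≤ 2 * m * z
  x+y≤2*m*z m {x} {y} {z} y≤x x≤mz = begin
    x + y          ≤⟨ +-monoʳ-≤ x y≤x ⟩
    x + x          ≤⟨ +-mono-≤ x≤mz x≤mz ⟩
    m * z + m * z  ≡⟨ double m z ⟩
    2 * m * z      ∎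
    where
    double : ∀ m z → m * z + m * z ≡ 2 * m * z
    double = solve-∀

  3[s+k+c]<3+2sk⇒c≤sk : ∀ {s k c} → 3 * (s + k + c) < 3 + 2 * s * k → c ≤ s * k
  3[s+k+c]<3+2sk⇒c≤sk {s} {k} {c} H = ≤-pred (*-cancelˡ-< 3 c (1 + s * k) (begin-strict
    3 * c                  ≤⟨ *-monoʳ-≤ 3 (m≤n+m c (s + k)) ⟩
    3 * (s + k + c)        <⟨ H ⟩
    3 + 2 * s * k          ≤⟨ +-monoʳ-≤ 3 (*-monoˡ-≤ k (*-monoˡ-≤ s (n≤1+n 2))) ⟩
    3 + 3 * s * k          ≡⟨ factor s k ⟩
    3 * (1 + s * k)        ∎))
    where
    factor : ∀ s k → 3 + 3 * s * k ≡ 3 * (1 + s * k)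
    factor = solve-∀

  3[s+k+c]<3+2sk⇒2[1+c]≤5[s-1][k-1] : ∀ {s k c} → 2 ≤ s → 2 ≤ k → 3 * (s + k + c) < 3 + 2 * s * k →
    2 * (1 + c) ≤ 5 * ((s ∸ 1) * (k ∸ 1))
  3[s+k+c]<3+2sk⇒2[1+c]≤5[s-1][k-1] {suc (suc a)} {suc (suc b)} {c} (s≤s (s≤s _)) (s≤s (s≤s _)) H =
    *-cancelˡ-≤ 3 (+-cancelʳ-≤ slack _ _ (begin
      3 * (2 * (1 + c)) + slack                   ≡⟨ lhs a b c ⟩
      2 * suc (3 * (2 + a + (2 + b) + c))         ≤⟨ *-monoʳ-≤ 2 H ⟩
      2 * (3 + 2 * (2 + a) * (2 + b))             ≤⟨ m≤m+n _ (13 + 13 * a + 13 * b + 11 * a * b) ⟩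
      _                                           ≡⟨ rhs a b ⟩
      3 * (5 * ((1 + a) * (1 + b))) + slack       ∎))
    where
    slack = 20 + 6 * a + 6 * b
    lhs : ∀ a b c → 3 * (2 * (1 + c)) + (20 + 6 * a + 6 * b) ≡ 2 * suc (3 * (2 + a + (2 + b) + c))
    lhs = solve-∀
    rhs : ∀ a b → 2 * (3 + 2 * (2 + a) * (2 + b)) + (13 + 13 * a + 13 * b + 11 * a * b)
                  ≡ 3 * (5 * ((1 + a) * (1 + b))) + (20 + 6 * a + 6 * b)
    rhs = solve-∀

  module _ {N : ℕ → ℕ} {s k c : ℕ} (hyp : Hypergeometric N s k c) where

    open Hypergeometric hyp

    hypergeometric-vanish : ∀ {i} → 0 < i + c → s ≤ i ⊎ k ≤ i → N (suc i) ≡ 0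
    hypergeometric-vanish {i} 0<i+c s≤i⊎k≤i =
      m*n≡0⇒m≡0 (N (suc i)) (suc i)
        (m*n≡0⇒m≡0 _ (i + c) {{>-nonZero 0<i+c}} (trans (ratio i) (rhs≡0 s≤i⊎k≤i)))
      where
      rhs≡0 : s ≤ i ⊎ k ≤ i → N i * (s ∸ i) * (k ∸ i) ≡ 0
      rhs≡0 (inj₁ s≤i) =
        trans (cong (λ a → N i * a * (k ∸ i)) (m≤n⇒m∸n≡0 s≤i)) (cong (_* (k ∸ i)) (*-zeroʳ (N i)))
      rhs≡0 (inj₂ k≤i) = trans (cong (N i * (s ∸ i) *_) (m≤n⇒m∸n≡0 k≤i)) (*-zeroʳ (N i * (s ∸ i)))

    module _ (s<k+c : s < k + c) (k<s+c : k < s + c) where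

      window-beyond-support : ∀ j → s ≤ j ⊎ k ≤ j → N (suc j) + N (2 + j) ≤ 32 * (N j + N (3 + j))
      window-beyond-support j below = subst₂ (λ a b → a + b ≤ 32 * (N j + N (3 + j)))
        (sym (hypergeometric-vanish 0<j+c below))
        (sym (hypergeometric-vanish (s≤s z≤n) (Sum.map m≤n⇒m≤1+n m≤n⇒m≤1+n below)))
        z≤n
        where
        0<j+c = <-≤-trans (balanced⇒0<c s<k+c k<s+c) (m≤n+m c j)

      window-within-support : ∀ j u v → suc j + u ≡ s → suc j + v ≡ k →
        N (suc j) + N (2 + j) ≤ 32 * (N j + N (3 + j))
      window-within-support j u v s≡ k≡ = compare (N (2 + j) ≤? N (suc j))
        where
        A = N j
        B = N (suc j)
        C = N (2 + j)
        D = N (3 + j)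
        u<v+c : u < v + c
        u<v+c = +-cancelˡ-< (suc j) u (v + c)
          (subst₂ _<_ (sym s≡) (trans (cong (_+ c) (sym k≡)) (+-assoc (suc j) v c)) s<k+c)
        v<u+c : v < u + c
        v<u+c = +-cancelˡ-< (suc j) v (u + c)
          (subst₂ _<_ (sym k≡) (trans (cong (_+ c) (sym s≡)) (+-assoc (suc j) u c)) k<s+c)
        s-offsets = ∸-offsets j u s≡
        k-offsets = ∸-offsets j v k≡
        e₁ : B * suc j * (j + c) ≡ A * suc u * suc v
        e₁ = trans (ratio j) (cong₂ (λ a b → A * a * b) (proj₁ s-offsets) (proj₁ k-offsets))
        e₂ : C * (2 + j) * (suc j + c) ≡ B * u * v
        e₂ = trans (ratio (suc j))
          (cong₂ (λ a b → B * a * b) (proj₁ (proj₂ s-offsets)) (proj₁ (proj₂ k-offsets)))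
        e₃ : D * (3 + j) * (2 + j + c) ≡ C * (u ∸ 1) * (v ∸ 1)
        e₃ = trans (ratio (2 + j))
          (cong₂ (λ a b → C * a * b) (proj₂ (proj₂ s-offsets)) (proj₂ (proj₂ k-offsets)))
        compare : Dec (C ≤ B) → B + C ≤ 32 * (A + D)
        compare (yes C≤B) = begin
          B + C         ≤⟨ x+y≤2*m*z 16 {z = A} C≤B (C≤B⇒B≤16A {A = A} j u v u<v+c v<u+c e₁ e₂ C≤B) ⟩
          32 * A        ≤⟨ *-monoʳ-≤ 32 (m≤m+n A D) ⟩
          32 * (A + D)  ∎
        compare (no C≰B) = begin
          B + C         ≡⟨ +-comm B C ⟩
          C + B         ≤⟨ x+y≤2*m*z 16 {z = D} (<⇒≤ B<C) (B<C⇒C≤16D {D = D} j u v u<v+c v<u+c e₂ e₃ B<C) ⟩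
          32 * D        ≤⟨ *-monoʳ-≤ 32 (m≤n+m D A) ⟩
          32 * (A + D)  ∎
          where
          B<C = ≰⇒> C≰B

      hypergeometric-window : ∀ j → N (suc j) + N (2 + j) ≤ 32 * (N j + N (3 + j))
      hypergeometric-window j with suc j ≤? s | suc j ≤? k
      ... | no 1+j≰s | _ = window-beyond-support j (inj₁ (≤-pred (≰⇒> 1+j≰s)))
      ... | yes _ | no 1+j≰k = window-beyond-support j (inj₂ (≤-pred (≰⇒> 1+j≰k)))
      ... | yes 1+j≤s | yes 1+j≤k =
        window-within-support j _ _ (proj₂ (m≤n⇒∃[o]m+o≡n 1+j≤s)) (proj₂ (m≤n⇒∃[o]m+o≡n 1+j≤k))

    hypergeometric-head : 2 ≤ s → 2 ≤ k → 3 * (s + k + c) < 3 + 2 * s * k → N 0 + N 1 ≤ 10 * N 2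
    hypergeometric-head 2≤s 2≤k H = begin
      N 0 + N 1  ≡⟨ +-comm (N 0) (N 1) ⟩
      N 1 + N 0  ≤⟨ x+y≤2*m*z 5 {z = N 2} N₀≤N₁ N₁≤5N₂ ⟩
      10 * N 2   ∎
      where
      instance
        s≢0 = >-nonZero (≤-trans (s≤s z≤n) 2≤s)
        k≢0 = >-nonZero (≤-trans (s≤s z≤n) 2≤k)
        sk≢0 = m*n≢0 s k
      N₀≤N₁ : N 0 ≤ N 1
      N₀≤N₁ = *-cancelʳ-≤ (N 0) (N 1) (s * k) (begin
        N 0 * (s * k)  ≡⟨ *-assoc (N 0) s k ⟨
        N 0 * s * k    ≡⟨ ratio 0 ⟨
        N 1 * 1 * c    ≡⟨ cong (_* c) (*-identityʳ (N 1)) ⟩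
        N 1 * c        ≤⟨ *-monoʳ-≤ (N 1) (3[s+k+c]<3+2sk⇒c≤sk {s} {k} H) ⟩
        N 1 * (s * k)  ∎)
      N₁≤5N₂ : N 1 ≤ 5 * N 2
      N₁≤5N₂ = *-cancelʳ-≤ (N 1) (5 * N 2) (2 * (1 + c)) (begin
        N 1 * (2 * (1 + c))                    ≤⟨ *-monoʳ-≤ (N 1) (3[s+k+c]<3+2sk⇒2[1+c]≤5[s-1][k-1] 2≤s 2≤k H) ⟩
        N 1 * (5 * ((s ∸ 1) * (k ∸ 1)))        ≡⟨ regroup (N 1) (s ∸ 1) (k ∸ 1) ⟩
        5 * (N 1 * (s ∸ 1) * (k ∸ 1))          ≡⟨ cong (5 *_) (ratio 1) ⟨
        5 * (N 2 * 2 * (1 + c))                ≡⟨ regroup′ (N 2) (1 + c) ⟩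
        5 * N 2 * (2 * (1 + c))                ∎)
        where
        regroup : ∀ a b d → a * (5 * (b * d)) ≡ 5 * (a * b * d)
        regroup = solve-∀
        regroup′ : ∀ a b → 5 * (a * 2 * b) ≡ 5 * a * (2 * b)
        regroup′ = solve-∀

module LevelCounts where

  open Sums
  open Binomial
  open HypergeometricBounds using (Hypergeometric; ∸-offsets)
  open import Data.Nat using (ℕ; zero; suc; _+_; _*_; _∸_; _≤_; _<_; _≡ᵇ_; s≤s; _≟_; _<?_)
  open import Data.Nat.Tactic.RingSolver using (solve-∀)
  open import Relation.Nullary using (yes; no)
  open import Data.Nat.Properties
  open import Data.Nat.Combinatorics using (_C_; nCk+nC[k+1]≡[n+1]C[k+1])
  open import Relation.Nullary.Decidable using (dec-false)
  open ≡-Reasoning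

  ∣p∣+∣∁p∣≡n : ∀ {n} (p : Subset n) → ∣ p ∣ + ∣ ∁ p ∣ ≡ n
  ∣p∣+∣∁p∣≡n [] = refl
  ∣p∣+∣∁p∣≡n (inside ∷ p) = cong suc (∣p∣+∣∁p∣≡n p)
  ∣p∣+∣∁p∣≡n (outside ∷ p) = trans (+-suc ∣ p ∣ ∣ ∁ p ∣) (cong suc (∣p∣+∣∁p∣≡n p))

  weight≡sumOver+sumOver∁ : ∀ {n} (S : Subset n) (x : Vec Bool n) → weight x ≡ sumOver S x + sumOver (∁ S) x
  weight≡sumOver+sumOver∁ [] [] = refl
  weight≡sumOver+sumOver∁ (inside ∷ S) (true ∷ x) = cong suc (weight≡sumOver+sumOver∁ S x)
  weight≡sumOver+sumOver∁ (inside ∷ S) (false ∷ x) = weight≡sumOver+sumOver∁ S x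
  weight≡sumOver+sumOver∁ (outside ∷ S) (true ∷ x) =
    trans (cong suc (weight≡sumOver+sumOver∁ S x)) (sym (+-suc (sumOver S x) _))
  weight≡sumOver+sumOver∁ (outside ∷ S) (false ∷ x) = weight≡sumOver+sumOver∁ S x

  count-cube : ∀ {n} (p : Vec Bool (suc n) → Bool) →
    count p (cube (suc n)) ≡ count (p ∘ (true ∷_)) (cube n) + count (p ∘ (false ∷_)) (cube n)
  count-cube {n} p = trans (∑-++ (bit ∘ p) (map (true ∷_) (cube n)) (map (false ∷_) (cube n)))
                           (cong₂ _+_ (∑-map (bit ∘ p) (true ∷_) (cube n)) (∑-map (bit ∘ p) (false ∷_) (cube n)))

  count-cube-sumOver : ∀ {n} (S : Subset n) t r →
    count (λ x → (sumOver S x ≡ᵇ t) ∧ (sumOver (∁ S) x ≡ᵇ r)) (cube n) ≡ (∣ S ∣ C t) * (∣ ∁ S ∣ C r)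
  count-cube-sumOver [] zero zero = refl
  count-cube-sumOver [] zero (suc r) = refl
  count-cube-sumOver [] (suc t) r = refl
  count-cube-sumOver {suc n} (inside ∷ S) t r =
    trans (count-cube (λ x → (sumOver (inside ∷ S) x ≡ᵇ t) ∧ (sumOver (∁ (inside ∷ S)) x ≡ᵇ r))) (split t)
    where
    R = ∣ ∁ S ∣ C r
    split : ∀ t → count (λ x → (suc (sumOver S x) ≡ᵇ t) ∧ (sumOver (∁ S) x ≡ᵇ r)) (cube n)
                  + count (λ x → (sumOver S x ≡ᵇ t) ∧ (sumOver (∁ S) x ≡ᵇ r)) (cube n)
                ≡ (suc ∣ S ∣ C t) * R
    split zero =
      trans (cong (_+ count (λ x → (sumOver S x ≡ᵇ 0) ∧ (sumOver (∁ S) x ≡ᵇ r)) (cube n)) (count-false (cube n)))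
            (count-cube-sumOver S zero r)
    split (suc t) = trans (cong₂ _+_ (count-cube-sumOver S t r) (count-cube-sumOver S (suc t) r)) (begin
      (∣ S ∣ C t) * R + (∣ S ∣ C suc t) * R  ≡⟨ *-distribʳ-+ R (∣ S ∣ C t) (∣ S ∣ C suc t) ⟨
      (∣ S ∣ C t + ∣ S ∣ C suc t) * R        ≡⟨ cong (_* R) (nCk+nC[k+1]≡[n+1]C[k+1] ∣ S ∣ t) ⟩
      (suc ∣ S ∣ C suc t) * R                ∎)
  count-cube-sumOver {suc n} (outside ∷ S) t r =
    trans (count-cube (λ x → (sumOver (outside ∷ S) x ≡ᵇ t) ∧ (sumOver (∁ (outside ∷ S)) x ≡ᵇ r))) (split r)
    where
    L = ∣ S ∣ C t
    split : ∀ r → count (λ x → (sumOver S x ≡ᵇ t) ∧ (suc (sumOver (∁ S) x) ≡ᵇ r)) (cube n)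
                  + count (λ x → (sumOver S x ≡ᵇ t) ∧ (sumOver (∁ S) x ≡ᵇ r)) (cube n)
                ≡ L * (suc ∣ ∁ S ∣ C r)
    split zero = trans (cong (_+ count (λ x → (sumOver S x ≡ᵇ t) ∧ (sumOver (∁ S) x ≡ᵇ 0)) (cube n)) vanish)
                       (count-cube-sumOver S t zero)
      where
      vanish : count (λ x → (sumOver S x ≡ᵇ t) ∧ false) (cube n) ≡ 0
      vanish = trans (∑-cong (λ x → cong bit (∧-zeroʳ (sumOver S x ≡ᵇ t))) (cube n)) (count-false (cube n))
    split (suc r) = trans (cong₂ _+_ (count-cube-sumOver S t r) (count-cube-sumOver S t (suc r))) (begin
      L * (∣ ∁ S ∣ C r) + L * (∣ ∁ S ∣ C suc r)
        ≡⟨ *-distribˡ-+ L (∣ ∁ S ∣ C r) (∣ ∁ S ∣ C suc r) ⟨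
      L * (∣ ∁ S ∣ C r + ∣ ∁ S ∣ C suc r)
        ≡⟨ cong (L *_) (nCk+nC[k+1]≡[n+1]C[k+1] ∣ ∁ S ∣ r) ⟩
      L * (suc ∣ ∁ S ∣ C suc r)
        ∎)

  m+n≡ᵇm+o≡n≡ᵇo : ∀ m n o → (m + n ≡ᵇ m + o) ≡ (n ≡ᵇ o)
  m+n≡ᵇm+o≡n≡ᵇo zero n o = refl
  m+n≡ᵇm+o≡n≡ᵇo (suc m) n o = m+n≡ᵇm+o≡n≡ᵇo m n o

  module Levels {n : ℕ} (S : Subset n) (k : ℕ) where

    level : ℕ → ℕ
    level t = count (λ x → sumOver S x ≡ᵇ t) (slice n k)

    level≡ : ∀ t r → t + r ≡ k → level t ≡ (∣ S ∣ C t) * (∣ ∁ S ∣ C r)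
    level≡ t r t+r≡k = begin
      level t                                                          ≡⟨ count-filterᵇ _ _ (cube n) ⟩
      count (λ x → (weight x ≡ᵇ k) ∧ (sumOver S x ≡ᵇ t)) (cube n)      ≡⟨ ∑-cong (cong bit ∘ split) (cube n) ⟩
      count (λ x → (sumOver S x ≡ᵇ t) ∧ (sumOver (∁ S) x ≡ᵇ r)) (cube n) ≡⟨ count-cube-sumOver S t r ⟩
      (∣ S ∣ C t) * (∣ ∁ S ∣ C r)                                      ∎
      where
      split : ∀ x → (weight x ≡ᵇ k) ∧ (sumOver S x ≡ᵇ t) ≡ (sumOver S x ≡ᵇ t) ∧ (sumOver (∁ S) x ≡ᵇ r)
      split x with sumOver S x ≡ᵇ t in Xx≡ᵇt
      ... | false = ∧-zeroʳ (weight x ≡ᵇ k)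
      ... | true = begin
        (weight x ≡ᵇ k) ∧ true                        ≡⟨ ∧-identityʳ _ ⟩
        (weight x ≡ᵇ k)                               ≡⟨ cong₂ _≡ᵇ_ (weight≡sumOver+sumOver∁ S x) (sym t+r≡k) ⟩
        (sumOver S x + sumOver (∁ S) x ≡ᵇ t + r)      ≡⟨ cong (λ a → a + sumOver (∁ S) x ≡ᵇ t + r) Xx≡t ⟩
        (t + sumOver (∁ S) x ≡ᵇ t + r)                ≡⟨ m+n≡ᵇm+o≡n≡ᵇo t (sumOver (∁ S) x) r ⟩
        (sumOver (∁ S) x ≡ᵇ r)                        ∎
        where
        Xx≡t = ≡ᵇ⇒≡ (sumOver S x) t (subst T (sym Xx≡ᵇt) _)

    level-vanish : ∀ t → k < t → level t ≡ 0
    level-vanish t k<t =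
      trans (count-filterᵇ _ _ (cube n)) (trans (∑-cong (cong bit ∘ none) (cube n)) (count-false (cube n)))
      where
      none : ∀ x → (weight x ≡ᵇ k) ∧ (sumOver S x ≡ᵇ t) ≡ false
      none x with sumOver S x ≡ᵇ t in Xx≡ᵇt
      ... | false = ∧-zeroʳ (weight x ≡ᵇ k)
      ... | true = trans (∧-identityʳ _) (dec-false (weight x ≟ k) λ wx≡k →
        <⇒≱ k<t (subst₂ _≤_ Xx≡t (trans (sym (weight≡sumOver+sumOver∁ S x)) wx≡k) (m≤m+n _ _)))
        where
        Xx≡t = ≡ᵇ⇒≡ (sumOver S x) t (subst T (sym Xx≡ᵇt) _)

    0<level₀ : k ≤ ∣ ∁ S ∣ → 0 < level 0
    0<level₀ k≤∣∁S∣ = subst (0 <_) (sym (trans (level≡ 0 k refl) (*-identityˡ _))) (k≤n⇒0<nCk k≤∣∁S∣)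

    level-ratio : k ≤ suc ∣ ∁ S ∣ → ∀ i →
      level (suc i) * suc i * (i + (suc ∣ ∁ S ∣ ∸ k)) ≡ level i * (∣ S ∣ ∸ i) * (k ∸ i)
    level-ratio k≤1+s′ i with i <? k
    ... | no i≮k = begin
      level (suc i) * suc i * (i + c)
        ≡⟨ cong (λ a → a * suc i * (i + c)) (level-vanish (suc i) (s≤s (≮⇒≥ i≮k))) ⟩
      0
        ≡⟨ *-zeroʳ (level i * (s ∸ i)) ⟨
      level i * (s ∸ i) * 0
        ≡⟨ cong (level i * (s ∸ i) *_) (m≤n⇒m∸n≡0 (≮⇒≥ i≮k)) ⟨
      level i * (s ∸ i) * (k ∸ i)
        ∎
      where
      s = ∣ S ∣
      c = suc ∣ ∁ S ∣ ∸ k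
    ... | yes i<k = begin
      level (suc i) * suc i * (i + c)
        ≡⟨ cong₂ (λ a b → a * suc i * b) (level≡ (suc i) r k≡) i+c≡s′∸r ⟩
      (s C suc i) * (s′ C r) * suc i * (s′ ∸ r)
        ≡⟨ regroup (s C suc i) (s′ C r) (suc i) (s′ ∸ r) ⟩
      (suc i * (s C suc i)) * ((s′ ∸ r) * (s′ C r))
        ≡⟨ cong₂ _*_ ([1+k]nC[1+k]≡[n∸k]nCk s i) (sym ([1+k]nC[1+k]≡[n∸k]nCk s′ r)) ⟩
      ((s ∸ i) * (s C i)) * (suc r * (s′ C suc r))
        ≡⟨ regroup′ (s ∸ i) (s C i) (suc r) (s′ C suc r) ⟩
      (s C i) * (s′ C suc r) * (s ∸ i) * suc r
        ≡⟨ cong₂ (λ a b → a * (s ∸ i) * b)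
                 (level≡ i (suc r) (trans (+-suc i r) k≡)) (proj₁ (∸-offsets i r k≡)) ⟨
      level i * (s ∸ i) * (k ∸ i)
        ∎
      where
      s = ∣ S ∣
      s′ = ∣ ∁ S ∣
      c = suc s′ ∸ k
      r = proj₁ (m≤n⇒∃[o]m+o≡n i<k)
      k≡ : suc i + r ≡ k
      k≡ = proj₂ (m≤n⇒∃[o]m+o≡n i<k)
      i+r≤s′ : i + r ≤ s′
      i+r≤s′ = ≤-pred (subst (_≤ suc s′) (sym k≡) k≤1+s′)
      i+c≡s′∸r : i + c ≡ s′ ∸ r
      i+c≡s′∸r = begin
        i + (suc s′ ∸ k)        ≡⟨ cong (λ a → i + (suc s′ ∸ a)) k≡ ⟨
        i + (s′ ∸ (i + r))      ≡⟨ cong (i +_) (trans (cong (s′ ∸_) (+-comm i r)) (sym (∸-+-assoc s′ r i))) ⟩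
        i + ((s′ ∸ r) ∸ i)      ≡⟨ m+[n∸m]≡n (m+n≤o⇒m≤o∸n i i+r≤s′) ⟩
        s′ ∸ r                  ∎
      regroup : ∀ a b d e → a * b * d * e ≡ (d * a) * (e * b)
      regroup = solve-∀
      regroup′ : ∀ a b d e → (a * b) * (d * e) ≡ b * e * a * d
      regroup′ = solve-∀

    level-hypergeometric : k ≤ suc ∣ ∁ S ∣ → Hypergeometric level ∣ S ∣ k (suc ∣ ∁ S ∣ ∸ k)
    level-hypergeometric k≤1+s′ = record { ratio = level-ratio k≤1+s′ }

module NaturalEmbedding where

  open import Data.Nat as ℕ using (ℕ; suc)
  open import Data.Integer as ℤ using (+_; +≤+)
  import Data.Integer.Properties as ℤ
  open import Data.Rational using (ℚ; mkℚ; 1ℚ; _+_; _*_; _/_; _≤_; *≤*)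
  open import Data.Rational.Properties using (normalize-coprime; drop-*≤*; *-inverseʳ)
  open import Data.Nat.Coprimality using (1-coprimeTo) renaming (sym to coprime-sym)

  ℕtoℚ≡mkℚ : ∀ a → ℕtoℚ a ≡ mkℚ (+ a) 0 (coprime-sym (1-coprimeTo a))
  ℕtoℚ≡mkℚ a = normalize-coprime (coprime-sym (1-coprimeTo a))

  ℕtoℚ-+ : ∀ a b → ℕtoℚ (a ℕ.+ b) ≡ ℕtoℚ a + ℕtoℚ b
  ℕtoℚ-+ a b rewrite ℕtoℚ≡mkℚ a | ℕtoℚ≡mkℚ b =
    cong (_/ 1) (sym (cong₂ ℤ._+_ (ℤ.*-identityʳ (+ a)) (ℤ.*-identityʳ (+ b))))

  ℕtoℚ-* : ∀ a b → ℕtoℚ (a ℕ.* b) ≡ ℕtoℚ a * ℕtoℚ b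
  ℕtoℚ-* a b rewrite ℕtoℚ≡mkℚ a | ℕtoℚ≡mkℚ b = cong (_/ 1) (sym (ℤ.+◃n≡+n (a ℕ.* b)))

  ℕtoℚ-mono-≤ : ∀ {a b} → a ℕ.≤ b → ℕtoℚ a ≤ ℕtoℚ b
  ℕtoℚ-mono-≤ {a} {b} a≤b rewrite ℕtoℚ≡mkℚ a | ℕtoℚ≡mkℚ b =
    *≤* (subst₂ ℤ._≤_ (sym (ℤ.*-identityʳ (+ a))) (sym (ℤ.*-identityʳ (+ b))) (+≤+ a≤b))

  ℕtoℚ-cancel-≤ : ∀ {a b} → ℕtoℚ a ≤ ℕtoℚ b → a ℕ.≤ b
  ℕtoℚ-cancel-≤ {a} {b} a≤b rewrite ℕtoℚ≡mkℚ a | ℕtoℚ≡mkℚ b =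
    ℤ.drop‿+≤+ (subst₂ ℤ._≤_ (ℤ.*-identityʳ (+ a)) (ℤ.*-identityʳ (+ b)) (drop-*≤* a≤b))

  [1+l]*1/[1+l]≡1 : ∀ l → ℕtoℚ (suc l) * (+ 1 / suc l) ≡ 1ℚ
  [1+l]*1/[1+l]≡1 l = trans (cong₂ _*_ (ℕtoℚ≡mkℚ (suc l)) (normalize-coprime (1-coprimeTo (suc l))))
                             (*-inverseʳ (mkℚ (+ suc l) 0 (coprime-sym (1-coprimeTo (suc l)))))

module Averages where

  open Sums using (bit; count)
  open NaturalEmbedding
  open import Data.Nat as ℕ using (ℕ; zero; suc)
  open import Data.Integer using (+_)
  open import Data.Rational using (ℚ; 0ℚ; 1ℚ; _+_; _*_; _/_; _≤_; _≤?_; nonNegative)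
  open import Data.Rational.Properties
  open import Relation.Nullary using (Dec; yes; no; does)
  open import Data.Rational.Solver using (module +-*-Solver)
  open +-*-Solver using (solve; _:*_; _:=_)
  open ≤-Reasoning

  sumℚ : {A : Set} → (A → ℚ) → List A → ℚ
  sumℚ h xs = foldr _+_ 0ℚ (map h xs)

  -- reciprocal 0 = 0 matches average [] = 0.
  reciprocal : ℕ → ℚ
  reciprocal zero = 0ℚ
  reciprocal (suc l) = + 1 / suc l

  0≤reciprocal : ∀ l → 0ℚ ≤ reciprocal l
  0≤reciprocal zero = ≤-refl
  0≤reciprocal (suc l) = nonNegative⁻¹ _ {{normalize-nonNeg 1 (suc l)}}

  module _ {A : Set} where

    average-map : ∀ (h : A → ℚ) xs → average (map h xs) ≡ sumℚ h xs * reciprocal (length xs)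
    average-map h xs = trans (average≡ (map h xs)) (cong (λ l → sumℚ h xs * reciprocal l) (length-map h xs))
      where
      average≡ : ∀ ys → average ys ≡ foldr _+_ 0ℚ ys * reciprocal (length ys)
      average≡ ys with length ys
      ... | zero = sym (*-zeroʳ (foldr _+_ 0ℚ ys))
      ... | suc l = refl

    sumℚ-mono : ∀ {g h : A → ℚ} → (∀ x → g x ≤ h x) → ∀ xs → sumℚ g xs ≤ sumℚ h xs
    sumℚ-mono g≤h [] = ≤-refl
    sumℚ-mono g≤h (x ∷ xs) = +-mono-≤ (g≤h x) (sumℚ-mono g≤h xs)

    sumℚ-*ˡ : ∀ c (h : A → ℚ) xs → sumℚ (λ x → c * h x) xs ≡ c * sumℚ h xs
    sumℚ-*ˡ c h [] = sym (*-zeroʳ c)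
    sumℚ-*ˡ c h (x ∷ xs) = trans (cong (_+_ (c * h x)) (sumℚ-*ˡ c h xs)) (sym (*-distribˡ-+ c (h x) (sumℚ h xs)))

    sumℚ-const : ∀ c (xs : List A) → sumℚ (λ _ → c) xs ≡ c * ℕtoℚ (length xs)
    sumℚ-const c [] = sym (*-zeroʳ c)
    sumℚ-const c (x ∷ xs) = begin-equality
      c + sumℚ (λ _ → c) xs           ≡⟨ cong (_+_ c) (sumℚ-const c xs) ⟩
      c + c * ℕtoℚ (length xs)        ≡⟨ cong (_+ c * ℕtoℚ (length xs)) (*-identityʳ c) ⟨
      c * 1ℚ + c * ℕtoℚ (length xs)   ≡⟨ *-distribˡ-+ c 1ℚ (ℕtoℚ (length xs)) ⟨
      c * (1ℚ + ℕtoℚ (length xs))     ≡⟨ cong (c *_) (ℕtoℚ-+ 1 (length xs)) ⟨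
      c * ℕtoℚ (suc (length xs))      ∎

    average-mono : ∀ {g h : A → ℚ} → (∀ x → g x ≤ h x) → ∀ xs → average (map g xs) ≤ average (map h xs)
    average-mono {g} {h} g≤h xs = begin
      average (map g xs)                           ≡⟨ average-map g xs ⟩
      sumℚ g xs * reciprocal (length xs)
        ≤⟨ *-monoʳ-≤-nonNeg _ {{nonNegative (0≤reciprocal (length xs))}} (sumℚ-mono g≤h xs) ⟩
      sumℚ h xs * reciprocal (length xs)           ≡⟨ average-map h xs ⟨
      average (map h xs)                           ∎

    average-*ˡ : ∀ c (h : A → ℚ) xs → average (map (λ x → c * h x) xs) ≡ c * average (map h xs)
    average-*ˡ c h xs = begin-equality
      average (map (λ x → c * h x) xs)             ≡⟨ average-map (λ x → c * h x) xs ⟩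
      sumℚ (λ x → c * h x) xs * reciprocal (length xs) ≡⟨ cong (_* reciprocal (length xs)) (sumℚ-*ˡ c h xs) ⟩
      c * sumℚ h xs * reciprocal (length xs)       ≡⟨ *-assoc c (sumℚ h xs) (reciprocal (length xs)) ⟩
      c * (sumℚ h xs * reciprocal (length xs))     ≡⟨ cong (c *_) (average-map h xs) ⟨
      c * average (map h xs)                       ∎

    sum≡length*average : ∀ (h : A → ℚ) xs → sumℚ h xs ≡ ℕtoℚ (length xs) * average (map h xs)
    sum≡length*average h [] = refl
    sum≡length*average h xs@(_ ∷ ys) = begin-equality
      sumℚ h xs                                    ≡⟨ *-identityʳ (sumℚ h xs) ⟨
      sumℚ h xs * 1ℚ                               ≡⟨ cong (sumℚ h xs *_) ([1+l]*1/[1+l]≡1 (length ys)) ⟨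
      sumℚ h xs * (ℕtoℚ N * reciprocal N)          ≡⟨ swap (sumℚ h xs) (ℕtoℚ N) (reciprocal N) ⟩
      ℕtoℚ N * (sumℚ h xs * reciprocal N)          ≡⟨ cong (ℕtoℚ N *_) (average-map h xs) ⟨
      ℕtoℚ N * average (map h xs)                  ∎
      where
      N = length xs
      swap : ∀ a b d → a * (b * d) ≡ b * (a * d)
      swap = solve 3 (λ a b d → a :* (b :* d) := b :* (a :* d)) refl

    average-const-≤ : ∀ {c} {h : A → ℚ} {xs} → 0 ℕ.< length xs → (∀ x → c ≤ h x) → c ≤ average (map h xs)
    average-const-≤ {c} {h} {xs@(_ ∷ ys)} _ c≤h = begin
      c                                       ≡⟨ *-identityʳ c ⟨
      c * 1ℚ                                  ≡⟨ cong (c *_) ([1+l]*1/[1+l]≡1 (length ys)) ⟨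
      c * (ℕtoℚ N * reciprocal N)             ≡⟨ *-assoc c (ℕtoℚ N) (reciprocal N) ⟨
      c * ℕtoℚ N * reciprocal N               ≡⟨ cong (_* reciprocal N) (sumℚ-const c xs) ⟨
      sumℚ (λ _ → c) xs * reciprocal N        ≡⟨ average-map (λ _ → c) xs ⟨
      average (map (λ _ → c) xs)              ≤⟨ average-mono c≤h xs ⟩
      average (map h xs)                      ∎
      where
      N = length xs

    markov : ∀ {c} {h : A → ℚ} → 0ℚ ≤ c → (∀ x → 0ℚ ≤ h x) → ∀ xs →
      c * ℕtoℚ (count (λ x → does (c ≤? h x)) xs) ≤ ℕtoℚ (length xs) * average (map h xs)
    markov {c} {h} 0≤c 0≤h xs = ≤-trans (markov-sum xs) (≤-reflexive (sum≡length*average h xs))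
      where
      markov-sum : ∀ xs → c * ℕtoℚ (count (λ x → does (c ≤? h x)) xs) ≤ sumℚ h xs
      markov-sum [] = ≤-reflexive (*-zeroʳ c)
      markov-sum (x ∷ xs) = step (c ≤? h x)
        where
        m = count (λ x → does (c ≤? h x)) xs
        step : (c≤?hx : Dec (c ≤ h x)) → c * ℕtoℚ (bit (does c≤?hx) ℕ.+ m) ≤ h x + sumℚ h xs
        step (yes c≤hx) = begin
          c * ℕtoℚ (1 ℕ.+ m)        ≡⟨ cong (c *_) (ℕtoℚ-+ 1 m) ⟩
          c * (1ℚ + ℕtoℚ m)         ≡⟨ *-distribˡ-+ c 1ℚ (ℕtoℚ m) ⟩
          c * 1ℚ + c * ℕtoℚ m       ≡⟨ cong (_+ c * ℕtoℚ m) (*-identityʳ c) ⟩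
          c + c * ℕtoℚ m            ≤⟨ +-mono-≤ c≤hx (markov-sum xs) ⟩
          h x + sumℚ h xs           ∎
        step (no _) = begin
          c * ℕtoℚ m                ≤⟨ markov-sum xs ⟩
          sumℚ h xs                 ≡⟨ +-identityˡ (sumℚ h xs) ⟨
          0ℚ + sumℚ h xs            ≤⟨ +-monoˡ-≤ (sumℚ h xs) (0≤h x) ⟩
          h x + sumℚ h xs           ∎

module NearIntegers where

  open NaturalEmbedding
  open import Data.Nat as ℕ using (ℕ)
  open import Data.Integer using (+_)
  open import Data.Rational using (ℚ; 0ℚ; 1ℚ; _+_; _*_; _-_; _/_; -_; _≤_; _<_; nonNegative)
  open import Data.Rational.Properties
  open import Relation.Nullary using (contradiction)
  open import Relation.Binary using (tri<; tri≈; tri>)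
  open import Data.Rational.Solver using (module +-*-Solver)
  open +-*-Solver using (solve; _:+_; _:*_; _:-_; :-_; con; _:=_)

  ½ ¼ : ℚ
  ½ = + 1 / 2
  ¼ = + 1 / 4

  0≤*0≤⇒0≤* : ∀ {a b} → 0ℚ ≤ a → 0ℚ ≤ b → 0ℚ ≤ a * b
  0≤*0≤⇒0≤* {a} {b} 0≤a 0≤b =
    nonNegative⁻¹ _ {{nonNeg*nonNeg⇒nonNeg a {{nonNegative 0≤a}} b {{nonNegative 0≤b}}}}

  0≤y-x⇒x≤y : ∀ {x y} → 0ℚ ≤ y - x → x ≤ y
  0≤y-x⇒x≤y {x} {y} 0≤y-x = subst₂ _≤_ (+-identityʳ x) (x+[y-x]≡y x y) (+-monoʳ-≤ x 0≤y-x)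
    where
    x+[y-x]≡y : ∀ x y → x + (y - x) ≡ y
    x+[y-x]≡y = solve 2 (λ x y → x :+ (y :- x) := y) refl

  x≤y⇒0≤y-x : ∀ {x y} → x ≤ y → 0ℚ ≤ y - x
  x≤y⇒0≤y-x {x} {y} x≤y = subst (_≤ y - x) (+-inverseʳ x) (+-monoˡ-≤ (- x) x≤y)

  ≤-by-product : ∀ {x y a b} → 0ℚ ≤ a → 0ℚ ≤ b → a * b ≡ y - x → x ≤ y
  ≤-by-product 0≤a 0≤b ab≡y-x = 0≤y-x⇒x≤y (subst (0ℚ ≤_) ab≡y-x (0≤*0≤⇒0≤* 0≤a 0≤b))

  ½≤x⇒¼≤x*x : ∀ {x} → ½ ≤ x → ¼ ≤ x * x
  ½≤x⇒¼≤x*x {x} ½≤x = ≤-by-product 0≤x-½ (+-mono-≤ 0≤x-½ (nonNegative⁻¹ 1ℚ)) (factor x)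
    where
    factor : ∀ x → (x - ½) * ((x - ½) + 1ℚ) ≡ x * x - ¼
    factor = solve 1 (λ x → (x :- con ½) :* ((x :- con ½) :+ con 1ℚ) := x :* x :- con ¼) refl
    0≤x-½ = x≤y⇒0≤y-x ½≤x

  -x*-x≡x*x : ∀ x → - x * - x ≡ x * x
  -x*-x≡x*x = solve 1 (λ x → (:- x) :* (:- x) := x :* x) refl

  0≤x*x : ∀ x → 0ℚ ≤ x * x
  0≤x*x x with ≤-total 0ℚ x
  ... | inj₁ 0≤x = 0≤*0≤⇒0≤* 0≤x 0≤x
  ... | inj₂ x≤0 = subst (0ℚ ≤_) (-x*-x≡x*x x) (0≤*0≤⇒0≤* (neg-antimono-≤ x≤0) (neg-antimono-≤ x≤0))

  x*x<¼⇒-½≤x≤½ : ∀ {x} → x * x < ¼ → - ½ ≤ x × x ≤ ½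
  x*x<¼⇒-½≤x≤½ {x} x²<¼ =
    ≮⇒≥ (λ x<-½ → too-large (subst (¼ ≤_) (-x*-x≡x*x x) (½≤x⇒¼≤x*x (<⇒≤ (neg-antimono-< x<-½))))) ,
    ≮⇒≥ (λ ½<x → too-large (½≤x⇒¼≤x*x (<⇒≤ ½<x)))
    where
    too-large : ¼ ≤ x * x → ⊥
    too-large ¼≤x² = <-irrefl refl (<-≤-trans x²<¼ ¼≤x²)

  module _ {d e : ℚ} (e≤½ : e ≤ ½) (1≤d : 1ℚ ≤ d) where

    private
      0≤d-1 = x≤y⇒0≤y-x 1≤d
      0≤½-e = x≤y⇒0≤y-x e≤½
      0≤2 : 0ℚ ≤ + 2 / 1
      0≤2 = nonNegative⁻¹ _

    1≤d⇒¼≤[d-e]² : ¼ ≤ (d - e) * (d - e)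
    1≤d⇒¼≤[d-e]² =
      ½≤x⇒¼≤x*x (0≤y-x⇒x≤y {½} {d - e} (subst (0ℚ ≤_) (regroup d e) (+-mono-≤ 0≤d-1 0≤½-e)))
      where
      regroup : ∀ d e → (d - 1ℚ) + (½ - e) ≡ (d - e) - ½
      regroup = solve 2 (λ d e → (d :- con 1ℚ) :+ (con ½ :- e) := (d :- e) :- con ½) refl

    1≤d⇒e²≤[d-e]² : e * e ≤ (d - e) * (d - e)
    1≤d⇒e²≤[d-e]² =
      ≤-by-product (+-mono-≤ 0≤d-1 (nonNegative⁻¹ 1ℚ)) (+-mono-≤ 0≤d-1 (0≤*0≤⇒0≤* 0≤2 0≤½-e)) (factor d e)
      where
      factor : ∀ d e → ((d - 1ℚ) + 1ℚ) * ((d - 1ℚ) + (+ 2 / 1) * (½ - e)) ≡ (d - e) * (d - e) - e * e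
      factor = solve 2 (λ d e → ((d :- con 1ℚ) :+ con 1ℚ) :* ((d :- con 1ℚ) :+ con (+ 2 / 1) :* (con ½ :- e))
                               := (d :- e) :* (d :- e) :- e :* e) refl

    1≤d⇒d²≤4[d-e]² : d * d ≤ (+ 4 / 1) * ((d - e) * (d - e))
    1≤d⇒d²≤4[d-e]² = ≤-by-product
      (+-mono-≤ 0≤d-1 (0≤*0≤⇒0≤* 0≤2 0≤½-e))
      (+-mono-≤ (+-mono-≤ (0≤*0≤⇒0≤* (nonNegative⁻¹ _) 0≤d-1) 0≤2) (0≤*0≤⇒0≤* 0≤2 0≤½-e))
      (factor d e)
      where
      factor : ∀ d e → ((d - 1ℚ) + (+ 2 / 1) * (½ - e)) * ((+ 3 / 1) * (d - 1ℚ) + (+ 2 / 1) + (+ 2 / 1) * (½ - e))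
                       ≡ (+ 4 / 1) * ((d - e) * (d - e)) - d * d
      factor = solve 2 (λ d e → ((d :- con 1ℚ) :+ con (+ 2 / 1) :* (con ½ :- e))
                                  :* (con (+ 3 / 1) :* (d :- con 1ℚ) :+ con (+ 2 / 1) :+ con (+ 2 / 1) :* (con ½ :- e))
                               := con (+ 4 / 1) :* ((d :- e) :* (d :- e)) :- d :* d) refl

  q<p⇒1≤p-q : ∀ {p q} → q ℕ.< p → 1ℚ ≤ ℕtoℚ p - ℕtoℚ q
  q<p⇒1≤p-q {p} {q} q<p = 0≤y-x⇒x≤y (subst (0ℚ ≤_) (regroup (ℕtoℚ p) (ℕtoℚ q))
    (x≤y⇒0≤y-x (subst (_≤ ℕtoℚ p) (ℕtoℚ-+ 1 q) (ℕtoℚ-mono-≤ q<p))))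
    where
    regroup : ∀ a b → a - (1ℚ + b) ≡ (a - b) - 1ℚ
    regroup = solve 2 (λ a b → a :- (con 1ℚ :+ b) := (a :- b) :- con 1ℚ) refl

  module _ {e : ℚ} (-½≤e : - ½ ≤ e) (e≤½ : e ≤ ½) where

    private
      -e≤½ : - e ≤ ½
      -e≤½ = neg-antimono-≤ -½≤e
      swap² : ∀ a b → (b - a) * (b - a) ≡ (a - b) * (a - b)
      swap² = solve 2 (λ a b → (b :- a) :* (b :- a) := (a :- b) :* (a :- b)) refl
      centred : ∀ e → e * e ≡ (0ℚ - e) * (0ℚ - e)
      centred = solve 1 (λ e → e :* e := (con 0ℚ :- e) :* (con 0ℚ :- e)) refl
      mirror : ∀ a b e → (b - a - - e) * (b - a - - e) ≡ (a - b - e) * (a - b - e)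
      mirror = solve 3 (λ a b e → (b :- a :- (:- e)) :* (b :- a :- (:- e)) := (a :- b :- e) :* (a :- b :- e)) refl

    integer-offset-d² : ∀ p q → let d = ℕtoℚ p - ℕtoℚ q in d * d ≤ (+ 4 / 1) * ((d - e) * (d - e))
    integer-offset-d² p q with ℕ.<-cmp p q
    ... | tri< p<q _ _ =
      subst₂ (λ a b → a ≤ (+ 4 / 1) * b) (swap² (ℕtoℚ p) (ℕtoℚ q)) (mirror (ℕtoℚ p) (ℕtoℚ q) e)
             (1≤d⇒d²≤4[d-e]² -e≤½ (q<p⇒1≤p-q p<q))
    ... | tri≈ _ refl _ = subst (λ d → d * d ≤ (+ 4 / 1) * ((d - e) * (d - e))) (sym (+-inverseʳ (ℕtoℚ p)))
                                (0≤*0≤⇒0≤* (nonNegative⁻¹ _) (0≤x*x (0ℚ - e)))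
    ... | tri> _ _ q<p = 1≤d⇒d²≤4[d-e]² e≤½ (q<p⇒1≤p-q q<p)

    integer-offset-e² : ∀ p q → let d = ℕtoℚ p - ℕtoℚ q in e * e ≤ (d - e) * (d - e)
    integer-offset-e² p q with ℕ.<-cmp p q
    ... | tri< p<q _ _ =
      subst₂ _≤_ (-x*-x≡x*x e) (mirror (ℕtoℚ p) (ℕtoℚ q) e) (1≤d⇒e²≤[d-e]² -e≤½ (q<p⇒1≤p-q p<q))
    ... | tri≈ _ refl _ = subst (λ d → e * e ≤ (d - e) * (d - e)) (sym (+-inverseʳ (ℕtoℚ p)))
                                (≤-reflexive (centred e))
    ... | tri> _ _ q<p = 1≤d⇒e²≤[d-e]² e≤½ (q<p⇒1≤p-q q<p)

    integer-offset-¼ : ∀ p q → p ≢ q → let d = ℕtoℚ p - ℕtoℚ q in ¼ ≤ (d - e) * (d - e)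
    integer-offset-¼ p q p≢q with ℕ.<-cmp p q
    ... | tri< p<q _ _ = subst (¼ ≤_) (mirror (ℕtoℚ p) (ℕtoℚ q) e) (1≤d⇒¼≤[d-e]² -e≤½ (q<p⇒1≤p-q p<q))
    ... | tri≈ _ p≡q _ = contradiction p≡q p≢q
    ... | tri> _ _ q<p = 1≤d⇒¼≤[d-e]² e≤½ (q<p⇒1≤p-q q<p)

module SliceStability where

  open Sums
  open HypergeometricBounds
  open LevelCounts
  open NaturalEmbedding
  open Averages
  open NearIntegers
  open import Data.Nat as ℕ using (ℕ; zero; suc)
  import Data.Nat.Properties as ℕ
  open import Data.Nat.Tactic.RingSolver using (solve-∀)
  open import Data.Integer using (+_)
  open import Data.Rational using (ℚ; _+_; _*_; _-_; _/_; -_; _≤_; _<_; _≤?_; nonNegative)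
  open import Data.Rational.Properties
  open import Data.Rational.Solver using (module +-*-Solver)
  open +-*-Solver using (solve; _:+_; _:*_; _:-_; :-_; con; _:=_)
  open import Relation.Nullary using (¬_; does; contradiction)
  open import Relation.Nullary.Decidable using (dec-true; decidable-stable)

  private
    2*x≡x+x : ∀ x → 2 ℕ.* x ≡ x ℕ.+ x
    2*x≡x+x = solve-∀

  aligned⇒in-window : ∀ b b₀ X X₀ → bit b ℕ.+ X₀ ≡ bit b₀ ℕ.+ X →
    X ≡ X₀ ℕ.∸ bit b₀ ⊎ X ≡ suc (X₀ ℕ.∸ bit b₀)
  aligned⇒in-window false false X X₀ eq = inj₁ (sym eq)
  aligned⇒in-window true false X X₀ eq = inj₂ (sym eq)
  aligned⇒in-window false true X (suc X₀) eq = inj₁ (sym (ℕ.suc-injective eq))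
  aligned⇒in-window true true X zero eq = inj₁ (sym (ℕ.suc-injective eq))
  aligned⇒in-window true true X (suc X₀) eq = inj₂ (sym (ℕ.suc-injective eq))

  toℚ≡ℕtoℚ∘bit : ∀ b → toℚ b ≡ ℕtoℚ (bit b)
  toℚ≡ℕtoℚ∘bit true = refl
  toℚ≡ℕtoℚ∘bit false = refl

  ∸bit≡0⇒bit-difference : ∀ b X₀ → X₀ ℕ.∸ bit b ≡ 0 → ∃ λ μ → toℚ μ ≡ ℕtoℚ (bit b) - ℕtoℚ X₀
  ∸bit≡0⇒bit-difference false zero _ = false , refl
  ∸bit≡0⇒bit-difference true zero _ = true , refl
  ∸bit≡0⇒bit-difference true (suc zero) _ = false , refl

  -- Markov leaves at most 4γ₁N < N/33 bad points, and 33 = 1 + 32 is what the window bound needs.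
  γ₁ : ℚ
  γ₁ = + 1 / 200

  ¼B≤Nγ₁⇒33B<N : ∀ B N → 0 ℕ.< N → ¼ * ℕtoℚ B ≤ ℕtoℚ N * γ₁ → 33 ℕ.* B ℕ.< N
  ¼B≤Nγ₁⇒33B<N zero N 0<N _ = 0<N
  ¼B≤Nγ₁⇒33B<N B@(suc _) N _ markov =
    ℕ.<-≤-trans (ℕ.*-monoˡ-< B {33} {50} (ℕ.m≤m+n 34 16)) (ℕtoℚ-cancel-≤ (begin
    ℕtoℚ (50 ℕ.* B)          ≡⟨ ℕtoℚ-* 50 B ⟩
    ℕtoℚ 50 * ℕtoℚ B         ≡⟨ scale-¼ (ℕtoℚ B) ⟩
    ℕtoℚ 200 * (¼ * ℕtoℚ B)  ≤⟨ *-monoˡ-≤-nonNeg (ℕtoℚ 200) markov ⟩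
    ℕtoℚ 200 * (ℕtoℚ N * γ₁) ≡⟨ scale-γ₁ (ℕtoℚ N) ⟩
    ℕtoℚ N                   ∎))
    where
    open ≤-Reasoning
    scale-¼ : ∀ x → ℕtoℚ 50 * x ≡ ℕtoℚ 200 * (¼ * x)
    scale-¼ = solve 1 (λ x → con (ℕtoℚ 50) :* x := con (ℕtoℚ 200) :* (con ¼ :* x)) refl
    scale-γ₁ : ∀ x → ℕtoℚ 200 * (x * γ₁) ≡ x
    scale-γ₁ = solve 1 (λ x → con (ℕtoℚ 200) :* (x :* con γ₁) := x) refl

  2sk≤3n⇒sk≤3/2n : ∀ {s k n} → 2 ℕ.* s ℕ.* k ℕ.≤ 3 ℕ.* n → ℕtoℚ s * ℕtoℚ k ≤ (+ 3 / 2) * ℕtoℚ n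
  2sk≤3n⇒sk≤3/2n {s} {k} {n} 2sk≤3n = begin
    ℕtoℚ s * ℕtoℚ k                       ≡⟨ halve (ℕtoℚ s) (ℕtoℚ k) ⟩
    ½ * (ℕtoℚ 2 * ℕtoℚ s * ℕtoℚ k)        ≡⟨ cong (λ z → ½ * (z * ℕtoℚ k)) (ℕtoℚ-* 2 s) ⟨
    ½ * (ℕtoℚ (2 ℕ.* s) * ℕtoℚ k)         ≡⟨ cong (½ *_) (ℕtoℚ-* (2 ℕ.* s) k) ⟨
    ½ * ℕtoℚ (2 ℕ.* s ℕ.* k)              ≤⟨ *-monoˡ-≤-nonNeg ½ (ℕtoℚ-mono-≤ 2sk≤3n) ⟩
    ½ * ℕtoℚ (3 ℕ.* n)                    ≡⟨ cong (½ *_) (ℕtoℚ-* 3 n) ⟩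
    ½ * (ℕtoℚ 3 * ℕtoℚ n)                 ≡⟨ halve′ (ℕtoℚ n) ⟩
    (+ 3 / 2) * ℕtoℚ n                    ∎
    where
    open ≤-Reasoning
    halve : ∀ a b → a * b ≡ ½ * (ℕtoℚ 2 * a * b)
    halve = solve 2 (λ a b → a :* b := con ½ :* (con (ℕtoℚ 2) :* a :* b)) refl
    halve′ : ∀ a → ½ * (ℕtoℚ 3 * a) ≡ (+ 3 / 2) * a
    halve′ = solve 1 (λ a → con ½ :* (con (ℕtoℚ 3) :* a) := con (+ 3 / 2) :* a) refl

  size-bounds⇒balanced : ∀ {s s′ k} → s ℕ.≤ s′ → k ℕ.≤ s′ → 2 ℕ.* k ℕ.≤ s ℕ.+ s′ →
    s ℕ.< k ℕ.+ (suc s′ ℕ.∸ k) × k ℕ.< s ℕ.+ (suc s′ ℕ.∸ k)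
  size-bounds⇒balanced {s} {s′} {k} s≤s′ k≤s′ 2k≤s+s′ =
    subst (s ℕ.<_) (sym (ℕ.m+[n∸m]≡n (ℕ.m≤n⇒m≤1+n k≤s′))) (ℕ.s≤s s≤s′) ,
    subst (k ℕ.<_) (sym s+[1+s′∸k]≡1+[s+s′∸k])
          (ℕ.s≤s (ℕ.m+n≤o⇒m≤o∸n k (subst (ℕ._≤ s ℕ.+ s′) (2*x≡x+x k) 2k≤s+s′)))
    where
    s+[1+s′∸k]≡1+[s+s′∸k] : s ℕ.+ (suc s′ ℕ.∸ k) ≡ suc (s ℕ.+ s′ ℕ.∸ k)
    s+[1+s′∸k]≡1+[s+s′∸k] = begin-equality
      s ℕ.+ (suc s′ ℕ.∸ k)    ≡⟨ ℕ.+-∸-assoc s (ℕ.m≤n⇒m≤1+n k≤s′) ⟨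
      s ℕ.+ suc s′ ℕ.∸ k      ≡⟨ cong (ℕ._∸ k) (ℕ.+-suc s s′) ⟩
      suc (s ℕ.+ s′) ℕ.∸ k    ≡⟨ ℕ.+-∸-assoc 1 (ℕ.≤-trans k≤s′ (ℕ.m≤n+m s′ s)) ⟩
      suc (s ℕ.+ s′ ℕ.∸ k)    ∎
      where open ℕ.≤-Reasoning

  small-side⇒2sk≤3n : ∀ {s k n} → 2 ℕ.* s ℕ.≤ n → 2 ℕ.* k ℕ.≤ n → s ℕ.≤ 1 ⊎ k ℕ.≤ 1 →
    2 ℕ.* s ℕ.* k ℕ.≤ 3 ℕ.* n
  small-side⇒2sk≤3n {s} {k} {n} 2s≤n 2k≤n small = ℕ.≤-trans (bound small) (ℕ.m≤n*m n 3)
    where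
    bound : s ℕ.≤ 1 ⊎ k ℕ.≤ 1 → 2 ℕ.* s ℕ.* k ℕ.≤ n
    bound (inj₁ s≤1) = ℕ.≤-trans (ℕ.*-monoˡ-≤ k (ℕ.*-monoʳ-≤ 2 s≤1)) 2k≤n
    bound (inj₂ k≤1) =
      ℕ.≤-trans (ℕ.*-monoʳ-≤ (2 ℕ.* s) k≤1) (ℕ.≤-trans (ℕ.≤-reflexive (ℕ.*-identityʳ (2 ℕ.* s))) 2s≤n)

  module _ {n k : ℕ} {f : Vec Bool n → Bool} {S : Subset n}
           (2k≤n : 2 ℕ.* k ℕ.≤ n) (2s≤n : 2 ℕ.* ∣ S ∣ ℕ.≤ n) {m : ℚ} (γ≤γ₁ : dist² n k f S m ≤ γ₁) where

    open Levels S k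

    private
      s = ∣ S ∣
      s′ = ∣ ∁ S ∣
      c = suc s′ ℕ.∸ k
      xs = slice n k
      N = length xs
      γ = dist² n k f S m
      X = sumOver S

    residual : ℚ → Vec Bool n → ℚ
    residual a x = toℚ (f x) - (ℕtoℚ (X x) + a)

    s+s′≡n : s ℕ.+ s′ ≡ n
    s+s′≡n = ∣p∣+∣∁p∣≡n S

    s≤s′ : s ℕ.≤ s′
    s≤s′ = ℕ.+-cancelˡ-≤ s s s′ (subst₂ ℕ._≤_ (2*x≡x+x s) (sym s+s′≡n) 2s≤n)

    k≤s′ : k ℕ.≤ s′
    k≤s′ = ℕ.*-cancelˡ-≤ 2 (begin
      2 ℕ.* k      ≤⟨ 2k≤n ⟩
      n            ≡⟨ s+s′≡n ⟨
      s ℕ.+ s′     ≤⟨ ℕ.+-monoˡ-≤ s′ s≤s′ ⟩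
      s′ ℕ.+ s′    ≡⟨ 2*x≡x+x s′ ⟨
      2 ℕ.* s′     ∎)
      where open ℕ.≤-Reasoning

    0<N : 0 ℕ.< N
    0<N = ℕ.<-≤-trans (0<level₀ k≤s′) (count≤length _ xs)

    bad : Vec Bool n → Bool
    bad x = does (¼ ≤? residual m x * residual m x)

    33*bad<N : 33 ℕ.* count bad xs ℕ.< N
    33*bad<N = ¼B≤Nγ₁⇒33B<N (count bad xs) N 0<N (≤-trans
      (markov (nonNegative⁻¹ ¼) (λ x → 0≤x*x (residual m x)) xs)
      (*-monoˡ-≤-nonNeg (ℕtoℚ N) {{nonNegative (ℕtoℚ-mono-≤ {0} {N} ℕ.z≤n)}} γ≤γ₁))

    private
      good-point : ∃ λ x → bad x ≡ false
      good-point = count<length⇒∃false bad xs (ℕ.≤-<-trans (ℕ.m≤n*m _ 33) 33*bad<N)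
      x₀ = proj₁ good-point
      X₀ = X x₀
      b₀ = f x₀
      a e : ℚ
      a = ℕtoℚ (bit b₀) - ℕtoℚ X₀
      e = m - a
      -- offset x is the integer d(x) of the proof idea, written as a difference of naturals.
      p q : Vec Bool n → ℕ
      p x = bit (f x) ℕ.+ X₀
      q x = bit b₀ ℕ.+ X x
      offset : Vec Bool n → ℚ
      offset x = ℕtoℚ (p x) - ℕtoℚ (q x)

    residual≡offset-e : ∀ x → residual m x ≡ offset x - e
    residual≡offset-e x = begin-equality
      toℚ (f x) - (ℕtoℚ (X x) + m)
        ≡⟨ cong (λ z → z - (ℕtoℚ (X x) + m)) (toℚ≡ℕtoℚ∘bit (f x)) ⟩
      ℕtoℚ (bit (f x)) - (ℕtoℚ (X x) + m)
        ≡⟨ regroup (ℕtoℚ (bit (f x))) (ℕtoℚ X₀) (ℕtoℚ (bit b₀)) (ℕtoℚ (X x)) m ⟩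
      (ℕtoℚ (bit (f x)) + ℕtoℚ X₀) - (ℕtoℚ (bit b₀) + ℕtoℚ (X x)) - e
        ≡⟨ cong₂ (λ y z → y - z - e) (ℕtoℚ-+ (bit (f x)) X₀) (ℕtoℚ-+ (bit b₀) (X x)) ⟨
      offset x - e
        ∎
      where
      open ≤-Reasoning
      regroup : ∀ F X₀ B₀ X m → F - (X + m) ≡ (F + X₀) - (B₀ + X) - (m - (B₀ - X₀))
      regroup = solve 5 (λ F X₀ B₀ X m → F :- (X :+ m) := (F :+ X₀) :- (B₀ :+ X) :- (m :- (B₀ :- X₀))) refl

    residual-at-level≡offset : ∀ x → residual a x ≡ offset x
    residual-at-level≡offset x = begin-equality
      toℚ (f x) - (ℕtoℚ (X x) + a)
        ≡⟨ cong (λ z → z - (ℕtoℚ (X x) + a)) (toℚ≡ℕtoℚ∘bit (f x)) ⟩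
      ℕtoℚ (bit (f x)) - (ℕtoℚ (X x) + a)
        ≡⟨ regroup (ℕtoℚ (bit (f x))) (ℕtoℚ X₀) (ℕtoℚ (bit b₀)) (ℕtoℚ (X x)) ⟩
      (ℕtoℚ (bit (f x)) + ℕtoℚ X₀) - (ℕtoℚ (bit b₀) + ℕtoℚ (X x))
        ≡⟨ cong₂ _-_ (ℕtoℚ-+ (bit (f x)) X₀) (ℕtoℚ-+ (bit b₀) (X x)) ⟨
      offset x
        ∎
      where
      open ≤-Reasoning
      regroup : ∀ F X₀ B₀ X → F - (X + (B₀ - X₀)) ≡ (F + X₀) - (B₀ + X)
      regroup = solve 4 (λ F X₀ B₀ X → F :- (X :+ (B₀ :- X₀)) := (F :+ X₀) :- (B₀ :+ X)) refl

    good⇒residual²<¼ : ∀ x → bad x ≡ false → residual m x * residual m x < ¼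
    good⇒residual²<¼ x good = ≰⇒> λ ¼≤r² →
      contradiction (trans (sym (dec-true (¼ ≤? residual m x * residual m x) ¼≤r²)) good) λ ()

    residual-at-x₀ : residual m x₀ ≡ - e
    residual-at-x₀ = begin-equality
      toℚ b₀ - (ℕtoℚ X₀ + m)             ≡⟨ cong (λ z → z - (ℕtoℚ X₀ + m)) (toℚ≡ℕtoℚ∘bit b₀) ⟩
      ℕtoℚ (bit b₀) - (ℕtoℚ X₀ + m)      ≡⟨ regroup (ℕtoℚ (bit b₀)) (ℕtoℚ X₀) m ⟩
      - e                                ∎
      where
      open ≤-Reasoning
      regroup : ∀ B₀ X₀ m → B₀ - (X₀ + m) ≡ - (m - (B₀ - X₀))
      regroup = solve 3 (λ B₀ X₀ m → B₀ :- (X₀ :+ m) := :- (m :- (B₀ :- X₀))) refl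

    e*e<¼ : e * e < ¼
    e*e<¼ = subst (_< ¼) (trans (cong (λ r → r * r) residual-at-x₀) (-x*-x≡x*x e))
                  (good⇒residual²<¼ x₀ (proj₂ good-point))

    private
      -½≤e : - ½ ≤ e
      -½≤e = proj₁ (x*x<¼⇒-½≤x≤½ {e} e*e<¼)
      e≤½ : e ≤ ½
      e≤½ = proj₂ (x*x<¼⇒-½≤x≤½ {e} e*e<¼)

    aligned-unless-bad : ∀ x → bad x ≡ false → p x ≡ q x
    aligned-unless-bad x good = decidable-stable (p x ℕ.≟ q x) λ p≢q →
      <-irrefl refl (<-≤-trans (good⇒residual²<¼ x good) (far p≢q))
      where
      far : p x ≢ q x → ¼ ≤ residual m x * residual m x
      far p≢q = subst (λ r → ¼ ≤ r * r) (sym (residual≡offset-e x)) (integer-offset-¼ -½≤e e≤½ (p x) (q x) p≢q)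

    t = X₀ ℕ.∸ bit b₀

    in-window-unless-bad : ∀ x → bad x ≡ false → X x ≡ t ⊎ X x ≡ suc t
    in-window-unless-bad x good = aligned⇒in-window (f x) b₀ (X x) X₀ (aligned-unless-bad x good)

    s<k+c×k<s+c : s ℕ.< k ℕ.+ c × k ℕ.< s ℕ.+ c
    s<k+c×k<s+c = size-bounds⇒balanced s≤s′ k≤s′ (subst (2 ℕ.* k ℕ.≤_) (sym s+s′≡n) 2k≤n)

    window-bounds : ∀ x → bad x ≡ false → t ℕ.≤ X x × X x ℕ.≤ suc t
    window-bounds x good = [ (λ Xx≡t → ℕ.≤-reflexive (sym Xx≡t) , subst (ℕ._≤ suc t) (sym Xx≡t) (ℕ.n≤1+n t))
                           , (λ Xx≡1+t → subst (t ℕ.≤_) (sym Xx≡1+t) (ℕ.n≤1+n t) , ℕ.≤-reflexive Xx≡1+t)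
                           ]′ (in-window-unless-bad x good)

    N≤window : ∀ {u} → t ≡ u → N ℕ.≤ level u ℕ.+ level (suc u) ℕ.+ count bad xs
    N≤window refl = count-cover cover xs
      where
      cover : ∀ x → T (X x ℕ.≡ᵇ t) ⊎ T (X x ℕ.≡ᵇ suc t) ⊎ T (bad x)
      cover x = [ inj₂ ∘ inj₂
                , (λ good → Sum.map (ℕ.≡⇒≡ᵇ (X x) t) (inj₁ ∘ ℕ.≡⇒≡ᵇ (X x) (suc t))
                                    (in-window-unless-bad x good))
                ]′ (T-or-false (bad x))

    bad-outside-window : ∀ x {u} → u ℕ.< t ⊎ suc t ℕ.< u → T (X x ℕ.≡ᵇ u) → T (bad x)
    bad-outside-window x {u} beyond Xx≡ᵇu =
      [ id , (λ good → ⊥-elim (outside-contradiction (bounds good))) ]′ (T-or-false (bad x))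
      where
      bounds : bad x ≡ false → t ℕ.≤ u × u ℕ.≤ suc t
      bounds good = subst (λ y → t ℕ.≤ y × y ℕ.≤ suc t) (ℕ.≡ᵇ⇒≡ (X x) u Xx≡ᵇu) (window-bounds x good)
      outside-contradiction : t ℕ.≤ u × u ℕ.≤ suc t → ⊥
      outside-contradiction (t≤u , u≤1+t) =
        [ (λ u<t → ℕ.<⇒≱ u<t t≤u) , (λ 1+t<u → ℕ.<⇒≱ 1+t<u u≤1+t) ]′ beyond

    bad-count-contradiction : ∀ K → K ℕ.≤ 33 → N ℕ.≤ K ℕ.* count bad xs → ⊥
    bad-count-contradiction K K≤33 N≤K*bad =
      ℕ.<-irrefl refl (ℕ.<-≤-trans 33*bad<N (ℕ.≤-trans N≤K*bad (ℕ.*-monoˡ-≤ (count bad xs) K≤33)))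

    t≢1+ : ∀ j → t ≢ suc j
    t≢1+ j t≡ = bad-count-contradiction 33 ℕ.≤-refl (begin
      N                                            ≤⟨ N≤window t≡ ⟩
      level (suc j) ℕ.+ level (2 ℕ.+ j) ℕ.+ B       ≤⟨ ℕ.+-monoˡ-≤ B window-bound ⟩
      32 ℕ.* (level j ℕ.+ level (3 ℕ.+ j)) ℕ.+ B   ≤⟨ ℕ.+-monoˡ-≤ B (ℕ.*-monoʳ-≤ 32 outside-bound) ⟩
      32 ℕ.* B ℕ.+ B                               ≡⟨ ℕ.+-comm (32 ℕ.* B) B ⟩
      33 ℕ.* B                                     ∎)
      where
      open ℕ.≤-Reasoning
      B = count bad xs
      window-bound : level (suc j) ℕ.+ level (2 ℕ.+ j) ℕ.≤ 32 ℕ.* (level j ℕ.+ level (3 ℕ.+ j))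
      window-bound = hypergeometric-window (level-hypergeometric (ℕ.m≤n⇒m≤1+n k≤s′))
                       (proj₁ s<k+c×k<s+c) (proj₂ s<k+c×k<s+c) j
      outside-bound : level j ℕ.+ level (3 ℕ.+ j) ℕ.≤ B
      outside-bound = count-disjoint
        (λ x → bad-outside-window x (inj₁ (subst (j ℕ.<_) (sym t≡) (ℕ.n<1+n j))))
        (λ x → bad-outside-window x (inj₂ (subst (λ t → suc t ℕ.< 3 ℕ.+ j) (sym t≡) (ℕ.n<1+n (2 ℕ.+ j)))))
        apart
        xs
        where
        apart : ∀ x → T (X x ℕ.≡ᵇ j) → T (X x ℕ.≡ᵇ 3 ℕ.+ j) → ⊥
        apart x Xx≡ᵇj Xx≡ᵇ3+j =
          ℕ.<-irrefl (trans (sym (ℕ.≡ᵇ⇒≡ (X x) j Xx≡ᵇj)) (ℕ.≡ᵇ⇒≡ (X x) (3 ℕ.+ j) Xx≡ᵇ3+j)) (ℕ.m<n+m j (ℕ.s≤s ℕ.z≤n))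

    t≡0 : t ≡ 0
    t≡0 = zero-unless-successor t refl
      where
      zero-unless-successor : ∀ u → t ≡ u → t ≡ 0
      zero-unless-successor zero t≡0 = t≡0
      zero-unless-successor (suc j) t≡1+j = ⊥-elim (t≢1+ j t≡1+j)

    2sk≤3n : 2 ℕ.* s ℕ.* k ℕ.≤ 3 ℕ.* n
    2sk≤3n = decidable-stable (2 ℕ.* s ℕ.* k ℕ.≤? 3 ℕ.* n) λ 2sk≰3n →
      bad-count-contradiction 11 (ℕ.m≤m+n 11 22) (begin
      N                                       ≤⟨ N≤window t≡0 ⟩
      level 0 ℕ.+ level 1 ℕ.+ B               ≤⟨ ℕ.+-monoˡ-≤ B (head-bound 2sk≰3n) ⟩
      10 ℕ.* level 2 ℕ.+ B                    ≤⟨ ℕ.+-monoˡ-≤ B (ℕ.*-monoʳ-≤ 10 level₂≤B) ⟩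
      10 ℕ.* B ℕ.+ B                          ≡⟨ ℕ.+-comm (10 ℕ.* B) B ⟩
      11 ℕ.* B                                ∎)
      where
      open ℕ.≤-Reasoning
      B = count bad xs
      large : ∀ {z} → ¬ (2 ℕ.* s ℕ.* k ℕ.≤ 3 ℕ.* n) → (z ℕ.≤ 1 → s ℕ.≤ 1 ⊎ k ℕ.≤ 1) → 2 ℕ.≤ z
      large 2sk≰3n small = ℕ.≰⇒> (λ z≤1 → 2sk≰3n (small-side⇒2sk≤3n 2s≤n 2k≤n (small z≤1)))
      s+k+c≡1+n : s ℕ.+ k ℕ.+ c ≡ suc n
      s+k+c≡1+n = begin-equality
        s ℕ.+ k ℕ.+ c        ≡⟨ ℕ.+-assoc s k c ⟩
        s ℕ.+ (k ℕ.+ c)      ≡⟨ cong (s ℕ.+_) (ℕ.m+[n∸m]≡n (ℕ.m≤n⇒m≤1+n k≤s′)) ⟩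
        s ℕ.+ suc s′         ≡⟨ ℕ.+-suc s s′ ⟩
        suc (s ℕ.+ s′)       ≡⟨ cong suc s+s′≡n ⟩
        suc n                ∎
      head-bound : ¬ (2 ℕ.* s ℕ.* k ℕ.≤ 3 ℕ.* n) → level 0 ℕ.+ level 1 ℕ.≤ 10 ℕ.* level 2
      head-bound 2sk≰3n =
        hypergeometric-head (level-hypergeometric (ℕ.m≤n⇒m≤1+n k≤s′)) (large 2sk≰3n inj₁) (large 2sk≰3n inj₂)
        (begin-strict
          3 ℕ.* (s ℕ.+ k ℕ.+ c)   ≡⟨ cong (3 ℕ.*_) s+k+c≡1+n ⟩
          3 ℕ.* suc n             ≡⟨ ℕ.*-suc 3 n ⟩
          3 ℕ.+ 3 ℕ.* n           <⟨ ℕ.+-monoʳ-< 3 (ℕ.≰⇒> 2sk≰3n) ⟩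
          3 ℕ.+ 2 ℕ.* s ℕ.* k     ∎)
      level₂≤B : level 2 ℕ.≤ B
      level₂≤B = count-mono (λ x → bad-outside-window x (inj₂ (subst (λ t → suc t ℕ.< 2) (sym t≡0) ℕ.≤-refl))) xs

    dist²-at-level : dist² n k f S a ≤ (+ 4 / 1) * γ
    dist²-at-level =
      ≤-trans (average-mono pointwise xs) (≤-reflexive (average-*ˡ (+ 4 / 1) (λ x → residual m x * residual m x) xs))
      where
      pointwise : ∀ x → residual a x * residual a x ≤ (+ 4 / 1) * (residual m x * residual m x)
      pointwise x = subst₂ (λ r r′ → r * r ≤ (+ 4 / 1) * (r′ * r′))
                           (sym (residual-at-level≡offset x)) (sym (residual≡offset-e x))
                           (integer-offset-d² -½≤e e≤½ (p x) (q x))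

    e*e≤γ : e * e ≤ γ
    e*e≤γ = average-const-≤ {xs = xs} 0<N λ x →
      subst (λ r → e * e ≤ r * r) (sym (residual≡offset-e x)) (integer-offset-e² -½≤e e≤½ (p x) (q x))

    e*e≤16γ : e * e ≤ (+ 4 / 1 * (+ 4 / 1)) * γ
    e*e≤16γ = ≤-trans e*e≤γ (≤-by-product (nonNegative⁻¹ (+ 15 / 1)) (≤-trans (0≤x*x e) e*e≤γ) (fifteen γ))
      where
      fifteen : ∀ γ → (+ 15 / 1) * γ ≡ (+ 4 / 1 * (+ 4 / 1)) * γ - γ
      fifteen = solve 1 (λ γ → con (+ 15 / 1) :* γ := con (+ 4 / 1 * (+ 4 / 1)) :* γ :- γ) refl

    stability : Σ Bool λ μ → (dist² n k f S (toℚ μ) ≤ (+ 4 / 1) * γ)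
                           × (ℕtoℚ s * ℕtoℚ k ≤ (+ 3 / 2) * ℕtoℚ n)
                           × ((m - toℚ μ) * (m - toℚ μ) ≤ (+ 4 / 1 * (+ 4 / 1)) * γ)
    stability =
      let μ , μ≡a = ∸bit≡0⇒bit-difference b₀ X₀ t≡0
      in μ , subst (λ z → dist² n k f S z ≤ (+ 4 / 1) * γ) (sym μ≡a) dist²-at-level
           , 2sk≤3n⇒sk≤3/2n {s} {k} {n} 2sk≤3n
           , subst (λ z → (m - z) * (m - z) ≤ (+ 4 / 1 * (+ 4 / 1)) * γ) (sym μ≡a) e*e≤16γ

open SliceStability using (γ₁; stability)
open import Data.Nat as ℕ using (ℕ)
open import Data.Integer using (+_)
open import Data.Rational using (ℚ; 0ℚ; _+_; _*_; _-_; _/_; _≤_; _<_)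
open import Data.Rational.Properties using (positive⁻¹; nonNegative⁻¹)

lemma13 : Σ ℚ λ γ₁ → Σ ℚ λ C → 0ℚ < γ₁ × 0ℚ ≤ C ×
    ((n k : ℕ) → 2 ℕ.≤ n → 2 ℕ.* k ℕ.≤ n →
     (f : Vec Bool n → Bool) (S : Subset n) → 2 ℕ.* ∣ S ∣ ℕ.≤ n → (m : ℚ) →
     dist² n k f S m ≤ γ₁ →
     Σ Bool λ μ →
       (dist² n k f S (toℚ μ) ≤ C * dist² n k f S m)
       × (k ≡ 0 ⊎ ℕtoℚ ∣ S ∣ * ℕtoℚ k ≤ (+ 3 / 2) * ℕtoℚ n)
       × ((m - toℚ μ) * (m - toℚ μ) ≤ (C * C) * dist² n k f S m))
lemma13 = γ₁ , + 4 / 1 , positive⁻¹ γ₁ , nonNegative⁻¹ (+ 4 / 1) ,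
  λ n k _ 2k≤n f S 2s≤n m γ≤γ₁ →
    let μ , close , size , near = stability {n} {k} {f} {S} 2k≤n 2s≤n {m} γ≤γ₁
    in μ , close , inj₂ size , near
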